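{- Let $n\ge1$, $k\ge1$, and let $\pi\in\mathcal{P}_n^{(k)}$ with first-layer blocks $B_1,\dots,B_r$. For each $i$ let $\pi_i\in\mathcal{P}^{(k)}(B_i)$ be the restriction of $\pi$ to $B_i$ (each layer restricted to $B_i$). Then $$\mu(\hat0,\pi)=\prod_{i=1}^{r}\mu(\hat0_{B_i},\pi_i),$$ where the left side is computed in $\mathcal{P}_n^{(k)}$ and the $i$-th factor in $\mathcal{P}^{(k)}(B_i)$.
   Context: For a finite nonempty set $S$ of positive integers, a weighted partition of $S$ with $k$ layers is a $k$-tuple $\pi=(\pi^{(1)},\dots,\pi^{(k)})$ of set partitions of $S$ such that $\pi^{(l+1)}$ refines $\pi^{(l)}$; $\mathcal{P}^{(k)}(S)$ is the set of these, and $\mathcal{P}_n^{(k)}=\mathcal{P}^{(k)}(\{1,\dots,n\})$. Labeled covers: for $\pi\in\mathcal{P}^{(k)}(S)$, $\alpha<\beta$ in $S$ and $l\in[k]$, the label $(\alpha,\beta)_l$ is admissible at $\pi$ if $\alpha,\beta$ lie in different blocks $A\ni\alpha$, $B\ni\beta$ of $\pi^{(1)}$, $\beta=\min B$, and $\alpha$ is the smallest element of its block in $\pi^{(l)}$; then $\pi'$ is obtained by replacing, for each $m=1,\dots,l$, the two blocks of $\pi^{(m)}$ containing $\alpha$ and $\beta$ by their union, with $\pi'^{(m)}=\pi^{(m)}$ for $m>l$, and we declare $\pi\lessdot\pi'$. The order on $\mathcal{P}^{(k)}(S)$ is the reflexive-transitive closure; $\hat0_S$ (written $\hat0$ for $S=[n]$)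 is the element all of whose layers are the partition of $S$ into singletons. The M\"obius function: $\mu(x,x)=1$, $\mu(x,y)=-\sum_{x\le z<y}\mu(x,z)$ for $x<y$. -}

module Defs where

open import Data.Bool using (Bool; true; false; if_then_else_; _∧_; _∨_; not; T)
open import Data.Nat using (ℕ; zero; suc; _≡ᵇ_; _≤ᵇ_; _<_; _⊓_)
import Data.Nat as ℕ
open import Data.Integer using (ℤ; -_) renaming (_+_ to _+ℤ_; _*_ to _*ℤ_; 0ℤ to 0ℤ; 1ℤ to 1ℤ)
open import Data.List using (List; []; _∷_; map; foldr; filterᵇ; length; concatMap; upTo; zip)
open import Data.Bool.ListAction using (any; all)
open import Data.List.Membership.Propositional using (_∈_)
import Data.List.Properties as LP
open import Data.Vec using (Vec; []; _∷_; lookup; tabulate)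
import Data.Vec.Properties as VP
open import Data.Fin using (Fin; toℕ)
open import Data.Product using (_×_; _,_)
open import Relation.Binary.PropositionalEquality using (_≡_; _≢_)
open import Relation.Binary.Definitions using (Decidable; DecidableEquality)
open import Relation.Binary.Construct.Closure.ReflexiveTransitive using (Star)
open import Relation.Nullary using (does)

-- A finite set S of positive integers is a strictly increasing List ℕ.
-- A set partition ("layer") p of S is encoded by its block-minimum map:
-- p is a list of the same length as S, the entry at the position of
-- s ∈ S being the minimum of the block containing s.  Blocks are the
-- fibres of this map.  A weighted partition with k layers is a
-- Vec (List ℕ) k (layer 1 = index 0).

Layer : Set
Layer = List ℕ

WP : ℕ → Set
WP k = Vec Layer k

lab : List ℕ → Layer → ℕ → ℕ
lab [] _ s = s
lab (x ∷ xs) [] s = s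
lab (x ∷ xs) (m ∷ ms) s = if x ≡ᵇ s then m else lab xs ms s

memᵇ : ℕ → List ℕ → Bool
memᵇ a xs = any (λ x → x ≡ᵇ a) xs

isPart : List ℕ → Layer → Bool
isPart S p = (length p ≡ᵇ length S) ∧
  all (λ { (s , m) → memᵇ m S ∧ (m ≤ᵇ s) ∧ (lab S p m ≡ᵇ m) }) (zip S p)

refinesᵇ : List ℕ → Layer → Layer → Bool
refinesᵇ S p q = all (λ s → all (λ t →
  not (lab S p s ≡ᵇ lab S p t) ∨ (lab S q s ≡ᵇ lab S q t)) S) S

chainRef : ∀ {k} → List ℕ → WP k → Bool
chainRef S [] = true
chainRef S (p ∷ []) = true
chainRef S (p ∷ q ∷ π) = refinesᵇ S q p ∧ chainRef S (q ∷ π)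

allParts : ∀ {k} → List ℕ → WP k → Bool
allParts S [] = true
allParts S (p ∷ π) = isPart S p ∧ allParts S π

isWP : ∀ {k} → List ℕ → WP k → Bool
isWP S π = allParts S π ∧ chainRef S π

-- first layer (for k = 0, which never occurs, the singleton partition)
layer1 : ∀ {k} → List ℕ → WP k → Layer
layer1 S [] = S
layer1 S (p ∷ π) = p

zeroWP : ∀ {k} → List ℕ → WP k
zeroWP {k} S = tabulate (λ _ → S)

mergeLayer : List ℕ → Layer → ℕ → ℕ → Layer
mergeLayer S p α β =
  map (λ m → if (m ≡ᵇ a) ∨ (m ≡ᵇ b) then a ⊓ b else m) p
  where
  a = lab S p α
  b = lab S p β

-- π' obtained from π via the label (α,β)_l ; l : Fin k is 0-based,
-- layers with index ≤ l are merged, the others unchanged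
mergeWP : ∀ {k} → List ℕ → WP k → ℕ → ℕ → Fin k → WP k
mergeWP S π α β l =
  tabulate (λ i → if toℕ i ≤ᵇ toℕ l then mergeLayer S (lookup π i) α β
                                      else lookup π i)

data Cover {k : ℕ} (S : List ℕ) (π π' : WP k) : Set where
  cover : (α β : ℕ) (l : Fin k) →
          T (isWP S π) →
          α ∈ S → β ∈ S → α < β →
          lab S (layer1 S π) α ≢ lab S (layer1 S π) β →
          lab S (layer1 S π) β ≡ β →
          lab S (lookup π l) α ≡ α →
          π' ≡ mergeWP S π α β l →
          Cover S π π'

Leq : ∀ {k} → List ℕ → WP k → WP k → Set
Leq S = Star (Cover S)

-- a decision procedure for the order (one exists since everything is finite;
-- the Möbius function below does not depend on which one is used)
LeqDec : Set
LeqDec = ∀ {k} (S : List ℕ) → Decidable (Leq {k} S)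

allLists : ℕ → List ℕ → List (List ℕ)
allLists zero xs = [] ∷ []
allLists (suc n) xs = concatMap (λ x → map (x ∷_) (allLists n xs)) xs

parts : List ℕ → List Layer
parts S = filterᵇ (isPart S) (allLists (length S) S)

allVecs : ∀ {A : Set} (k : ℕ) → List A → List (Vec A k)
allVecs zero xs = [] ∷ []
allVecs (suc k) xs = concatMap (λ x → map (x ∷_) (allVecs k xs)) xs

enumWP : (k : ℕ) → List ℕ → List (WP k)
enumWP k S = filterᵇ (isWP S) (allVecs k (parts S))

_≟WP_ : ∀ {k} → DecidableEquality (WP k)
_≟WP_ = VP.≡-dec (LP.≡-dec ℕ._≟_)

sumℤ : List ℤ → ℤ
sumℤ = foldr _+ℤ_ 0ℤ

productℤ : List ℤ → ℤ
productℤ = foldr _*ℤ_ 1ℤ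

μfuel : ℕ → LeqDec → ∀ {k} → List ℕ → WP k → WP k → ℤ
μfuel zero dec S x y = 0ℤ
μfuel (suc f) dec {k} S x y with does (x ≟WP y)
... | true = 1ℤ
... | false = - sumℤ (map (λ z →
        if does (dec S x z) ∧ does (dec S z y) ∧ not (does (z ≟WP y))
        then μfuel f dec S x z else 0ℤ) (enumWP k S))

-- fuel exceeding |𝒫^(k)(S)| bounds the length of every strict chain
μ : LeqDec → ∀ {k} → List ℕ → WP k → WP k → ℤ
μ dec {k} S x y = μfuel (suc (length (enumWP k S))) dec S x y

range : ℕ → List ℕ
range n = map suc (upTo n)

blocks1 : ∀ {k} → List ℕ → WP k → List (List ℕ)
blocks1 S π =
  map (λ m → filterᵇ (λ t → lab S (layer1 S π) t ≡ᵇ m) S)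
      (filterᵇ (λ m → lab S (layer1 S π) m ≡ᵇ m) S)

restrict : ∀ {k} → List ℕ → WP k → List ℕ → WP k
restrict S π B = Data.Vec.map (λ p → map (lab S p) B) π

-- Write [n] = C ⊔ D with C a block of the first layer of π and D the union of the others.
-- A cover below π merges two blocks inside C or two blocks inside D, never across, so
-- restriction z ↦ (z|C, z|D) is an order isomorphism from the interval [0̂, π] onto
-- [0̂_C, π|C] × [0̂_D, π|D], inverted by gluing. The sum over an interval of
-- z ↦ μ(0̂_C, z|C) μ(0̂_D, z|D) is then a product of two Möbius sums and vanishes off 0̂,
-- so this function satisfies the recursion that determines μ(0̂, _) on [0̂, π].
-- Hence μ(0̂, π) = μ(0̂_C, π|C) μ(0̂_D, π|D), and induction on the number of blocks gives
-- the theorem. The order is antisymmetric, as the recursion requires, because every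
-- cover strictly decreases the sum of the block labels of the first layer.

module Submission where

open import Defs
open import Data.Bool using (Bool; true; false; if_then_else_; _∧_; _∨_; not; T)
open import Data.Bool.ListAction using (all)
open import Data.Bool.Properties using (T-∧; T-∨; T-≡; T-not-≡; ∧-assoc; not-involutive)
open import Data.Empty using (⊥-elim)
open import Data.Fin using (zero; suc; toℕ)
open import Data.Integer using (ℤ; 0ℤ; 1ℤ; -_; _+_; _*_)
import Data.Integer.Properties as ℤ
open import Algebra.Properties.AbelianGroup ℤ.+-0-abelianGroup using (inverseˡ-unique)
open import Data.List using (List; []; _∷_; _++_; map; length; zip; filterᵇ; cartesianProduct; cartesianProductWith; concatMap)
import Data.List.Properties as List
open import Data.List.Membership.Propositional using (_∈_; _∉_)
open import Data.List.Membership.Propositional.Properties using (∈-map⁺; ∈-map⁻; ∈-filter⁺; ∈-filter⁻; ∈-cartesianProduct⁺; ∈-cartesianProduct⁻; ∈-cartesianProductWith⁺)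
open import Data.List.Membership.Propositional.Properties.WithK using (unique∧set⇒bag)
open import Data.List.Relation.Binary.BagAndSetEquality using (∼bag⇒↭)
open import Data.List.Relation.Binary.Permutation.Propositional using (_↭_; ↭⇒↭ₛ)
import Data.List.Relation.Binary.Permutation.Propositional.Properties as ↭
open import Data.List.Relation.Binary.Permutation.Setoid.Properties using (foldr-commMonoid)
open import Data.List.Relation.Unary.All using (All; [])
import Data.List.Relation.Unary.All as All
import Data.List.Relation.Unary.All.Properties as Allₚ
open import Data.List.Relation.Unary.Any using (here; there)
import Data.List.Relation.Unary.Any as Any
import Data.List.Relation.Unary.Any.Properties as Anyₚ
open import Data.List.Relation.Unary.Unique.Propositional using (Unique; []; _∷_)
import Data.List.Relation.Unary.Unique.Propositional.Properties as Unique
open import Data.Nat using (ℕ; zero; suc; _≡ᵇ_; _≤ᵇ_; _≤_; _<_; _⊓_; z≤n; s≤s)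
open import Data.Nat.Induction using (<-wellFounded)
open import Data.Nat.ListAction using (sum)
import Data.Nat.Properties as ℕ
open import Data.Product using (_×_; _,_; proj₁; proj₂)
open import Data.Sum using (_⊎_; inj₁; inj₂)
open import Data.Unit using (tt)
open import Data.Vec using (Vec; []; _∷_; lookup; zipWith)
import Data.Vec as Vec
import Data.Vec.Properties as Vec
open import Function using (_∘_; _⇔_; mk⇔; Equivalence)
open import Induction.WellFounded using (Acc; acc)
open import Relation.Binary.Construct.Closure.ReflexiveTransitive using (ε; _◅_; _◅◅_)
open import Relation.Binary.Definitions using (DecidableEquality; tri<; tri≈; tri>)
open import Relation.Binary.PropositionalEquality
open import Relation.Nullary using (¬_; Dec; yes; no; does; contradiction)
open import Relation.Nullary.Decidable using (dec-true; dec-false; T?)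

open Equivalence using (to; from)

sumℤ-++ : ∀ xs ys → sumℤ (xs ++ ys) ≡ sumℤ xs + sumℤ ys
sumℤ-++ [] ys = sym (ℤ.+-identityˡ _)
sumℤ-++ (x ∷ xs) ys = trans (cong (x +_) (sumℤ-++ xs ys)) (sym (ℤ.+-assoc x _ _))

sumℤ-map-* : {X : Set} (c : ℤ) (f : X → ℤ) (xs : List X) →
  sumℤ (map (λ z → c * f z) xs) ≡ c * sumℤ (map f xs)
sumℤ-map-* c f [] = sym (ℤ.*-zeroʳ c)
sumℤ-map-* c f (x ∷ xs) = trans (cong (c * f x +_) (sumℤ-map-* c f xs)) (sym (ℤ.*-distribˡ-+ c _ _))

sumℤ-cartesianProduct : {X Y : Set} (f : X → ℤ) (g : Y → ℤ) (xs : List X) (ys : List Y) →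
  sumℤ (map (λ p → f (proj₁ p) * g (proj₂ p)) (cartesianProduct xs ys)) ≡ sumℤ (map f xs) * sumℤ (map g ys)
sumℤ-cartesianProduct f g [] ys = sym (ℤ.*-zeroˡ (sumℤ (map g ys)))
sumℤ-cartesianProduct {X} {Y} f g (x ∷ xs) ys = begin
  sumℤ (map h (map (x ,_) ys ++ cartesianProduct xs ys))
    ≡⟨ cong sumℤ (List.map-++ h (map (x ,_) ys) _) ⟩
  sumℤ (map h (map (x ,_) ys) ++ map h (cartesianProduct xs ys))
    ≡⟨ sumℤ-++ (map h (map (x ,_) ys)) _ ⟩
  sumℤ (map h (map (x ,_) ys)) + sumℤ (map h (cartesianProduct xs ys))
    ≡⟨ cong₂ _+_ (trans (cong sumℤ (sym (List.map-∘ {g = h} {f = x ,_} ys))) (sumℤ-map-* (f x) g ys))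
                 (sumℤ-cartesianProduct f g xs ys) ⟩
  f x * sumℤ (map g ys) + sumℤ (map f xs) * sumℤ (map g ys)
    ≡⟨ sym (ℤ.*-distribʳ-+ _ (f x) _) ⟩
  sumℤ (map f (x ∷ xs)) * sumℤ (map g ys) ∎
  where
  open ≡-Reasoning
  h : X × Y → ℤ
  h p = f (proj₁ p) * g (proj₂ p)

sumℤ-↭ : ∀ {xs ys} → xs ↭ ys → sumℤ xs ≡ sumℤ ys
sumℤ-↭ p = foldr-commMonoid (setoid ℤ) ℤ.+-0-isCommutativeMonoid (↭⇒↭ₛ p)

sumℤ-map-unique : {X : Set} (f : X → ℤ) {xs ys : List X} → Unique xs → Unique ys →
  (∀ {z} → z ∈ xs ⇔ z ∈ ys) → sumℤ (map f xs) ≡ sumℤ (map f ys)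
sumℤ-map-unique f ux uy xs⇔ys = sumℤ-↭ (↭.map⁺ f (∼bag⇒↭ (unique∧set⇒bag ux uy xs⇔ys)))

sumIf : {X : Set} → List X → (X → Bool) → (X → ℤ) → ℤ
sumIf L b f = sumℤ (map (λ z → if b z then f z else 0ℤ) L)

sumIf-cong : {X : Set} (L : List X) {b b′ : X → Bool} {f g : X → ℤ} →
  (∀ {z} → z ∈ L → b z ≡ b′ z) → (∀ {z} → z ∈ L → T (b z) → f z ≡ g z) →
  sumIf L b f ≡ sumIf L b′ g
sumIf-cong [] eb ef = refl
sumIf-cong (x ∷ L) {b} {b′} eb ef = cong₂ _+_ head (sumIf-cong L (eb ∘ there) (ef ∘ there))
  where
  head : (if b x then _ else 0ℤ) ≡ (if b′ x then _ else 0ℤ)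
  head with b x | b′ x | eb (here refl) | ef (here refl)
  ... | true  | .true  | refl | e = e tt
  ... | false | .false | refl | _ = refl

sumIf-none : {X : Set} (L : List X) {b : X → Bool} (f : X → ℤ) →
  (∀ {z} → z ∈ L → ¬ T (b z)) → sumIf L b f ≡ 0ℤ
sumIf-none [] f none = refl
sumIf-none (x ∷ L) {b} f none with b x | none (here refl)
... | true  | ¬bx = contradiction tt ¬bx
... | false | _   = trans (ℤ.+-identityˡ _) (sumIf-none L f (none ∘ there))

sumIf-filter : {X : Set} (L : List X) (b : X → Bool) (f : X → ℤ) →
  sumIf L b f ≡ sumℤ (map f (filterᵇ b L))
sumIf-filter [] b f = refl
sumIf-filter (x ∷ L) b f with b x
... | true  = cong (f x +_) (sumIf-filter L b f)
... | false = trans (ℤ.+-identityˡ _) (sumIf-filter L b f)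

∈-filterᵇ⇔ : {X : Set} (b : X → Bool) (L : List X) {z : X} → z ∈ filterᵇ b L ⇔ (z ∈ L × T (b z))
∈-filterᵇ⇔ b L = mk⇔ (∈-filter⁻ (T? ∘ b)) (λ (m , bz) → ∈-filter⁺ (T? ∘ b) m bz)

filterᵇ-unique : {X : Set} (b : X → Bool) {L : List X} → Unique L → Unique (filterᵇ b L)
filterᵇ-unique b = Unique.filter⁺ (T? ∘ b)

sumIf-extract : {X : Set} (_≟_ : DecidableEquality X) {L : List X} → Unique L →
  {b : X → Bool} (f : X → ℤ) {y : X} → y ∈ L → T (b y) →
  sumIf L b f ≡ f y + sumIf L (λ z → b z ∧ not (does (z ≟ y))) f
sumIf-extract {X} _≟_ {L} uL {b} f {y} y∈L by = begin
  sumIf L b f                                     ≡⟨ sumIf-filter L b f ⟩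
  sumℤ (map f (filterᵇ b L))                      ≡⟨ sumℤ-map-unique f (filterᵇ-unique b uL) (Allₚ.¬Any⇒All¬ _ y∉rest ∷ filterᵇ-unique b′ uL) same ⟩
  f y + sumℤ (map f (filterᵇ b′ L))               ≡⟨ cong (f y +_) (sym (sumIf-filter L b′ f)) ⟩
  f y + sumIf L b′ f                              ∎
  where
  open ≡-Reasoning
  b′ : X → Bool
  b′ z = b z ∧ not (does (z ≟ y))
  y∉rest : y ∉ filterᵇ b′ L
  y∉rest m with trans (sym (dec-true (y ≟ y) refl)) (to T-not-≡ (proj₂ (to T-∧ (proj₂ (to (∈-filterᵇ⇔ b′ L) m)))))
  ... | ()
  same : ∀ {z} → z ∈ filterᵇ b L ⇔ z ∈ y ∷ filterᵇ b′ L
  same {z} = mk⇔ into-cons out-of-cons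
    where
    into-cons : z ∈ filterᵇ b L → z ∈ y ∷ filterᵇ b′ L
    into-cons m with to (∈-filterᵇ⇔ b L) m | z ≟ y
    ... | _ | yes z≡y = here z≡y
    ... | (z∈L , bz) | no z≢y = there (from (∈-filterᵇ⇔ b′ L) (z∈L , from T-∧ (bz , from T-not-≡ (dec-false (z ≟ y) z≢y))))
    out-of-cons : z ∈ y ∷ filterᵇ b′ L → z ∈ filterᵇ b L
    out-of-cons (here refl) = from (∈-filterᵇ⇔ b L) (y∈L , by)
    out-of-cons (there m) with to (∈-filterᵇ⇔ b′ L) m
    ... | z∈L , t = from (∈-filterᵇ⇔ b L) (z∈L , proj₁ (to T-∧ t))

≡ᵇ-true : ∀ {x y} → x ≡ y → (x ≡ᵇ y) ≡ true
≡ᵇ-true {x} {y} = dec-true (x ℕ.≟ y)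

≡ᵇ-false : ∀ {x y} → x ≢ y → (x ≡ᵇ y) ≡ false
≡ᵇ-false {x} {y} = dec-false (x ℕ.≟ y)

T-≡ᵇ⇔ : ∀ {x y} → T (x ≡ᵇ y) ⇔ x ≡ y
T-≡ᵇ⇔ {x} {y} = mk⇔ (ℕ.≡ᵇ⇒≡ x y) (ℕ.≡⇒≡ᵇ x y)

T-memᵇ⇔ : ∀ {m S} → T (memᵇ m S) ⇔ m ∈ S
T-memᵇ⇔ {m} {S} = mk⇔ (Any.map (sym ∘ to T-≡ᵇ⇔) ∘ Anyₚ.any⁻ _ S) (Anyₚ.any⁺ _ ∘ Any.map (from T-≡ᵇ⇔ ∘ sym))

lab-self : ∀ S s → lab S S s ≡ s
lab-self [] s = refl
lab-self (x ∷ S) s with x ℕ.≟ s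
... | yes x≡s rewrite ≡ᵇ-true x≡s = x≡s
... | no x≢s rewrite ≡ᵇ-false x≢s = lab-self S s

lab-relabel : ∀ (f : ℕ → ℕ) {S p s} → length p ≡ length S → s ∈ S → lab S (map f p) s ≡ f (lab S p s)
lab-relabel f {x ∷ S} {m ∷ p} {s} len s∈S with x ℕ.≟ s | s∈S
... | yes x≡s | _ rewrite ≡ᵇ-true x≡s = refl
... | no x≢s | here s≡x = contradiction (sym s≡x) x≢s
... | no x≢s | there s∈S′ rewrite ≡ᵇ-false x≢s = lab-relabel f (ℕ.suc-injective len) s∈S′

lab∈ : ∀ {S p s} → length p ≡ length S → s ∈ S → lab S p s ∈ p
lab∈ {x ∷ S} {m ∷ p} {s} len s∈S with x ℕ.≟ s | s∈S
... | yes x≡s | _ rewrite ≡ᵇ-true x≡s = here refl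
... | no x≢s | here s≡x = contradiction (sym s≡x) x≢s
... | no x≢s | there s∈S′ rewrite ≡ᵇ-false x≢s = there (lab∈ (ℕ.suc-injective len) s∈S′)

-- A layer is read by lab and written by map, as lookup and tabulate for vectors.
lab∘map : ∀ (g : ℕ → ℕ) {S s} → s ∈ S → lab S (map g S) s ≡ g s
lab∘map g {x ∷ S} {s} s∈S with x ℕ.≟ s | s∈S
... | yes x≡s | _ rewrite ≡ᵇ-true x≡s = cong g x≡s
... | no x≢s | here s≡x = contradiction (sym s≡x) x≢s
... | no x≢s | there s∈S′ rewrite ≡ᵇ-false x≢s = lab∘map g s∈S′

map∘lab : ∀ {S p} → Unique S → length p ≡ length S → map (lab S p) S ≡ p
map∘lab {[]} {[]} _ _ = refl
map∘lab {x ∷ S} {m ∷ p} (x∉S ∷ uS) len rewrite ≡ᵇ-true (refl {x = x}) =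
  cong (m ∷_) (trans (List.map-cong-local (All.tabulate rest)) (map∘lab uS (ℕ.suc-injective len)))
  where
  rest : ∀ {y} → y ∈ S → (if x ≡ᵇ y then m else lab S p y) ≡ lab S p y
  rest y∈S rewrite ≡ᵇ-false (All.lookup x∉S y∈S) = refl

record IsPartition (S : List ℕ) (p : Layer) : Set where
  field
    length≡  : length p ≡ length S
    lab∈S    : ∀ {s} → s ∈ S → lab S p s ∈ S
    lab≤     : ∀ {s} → s ∈ S → lab S p s ≤ s
    lab-idem : ∀ {s} → s ∈ S → lab S p (lab S p s) ≡ lab S p s

-- The test isPart applies to each pair (s, m) of zip S p; with projections instead of a
-- pattern lambda it is definitionally the one in isPart.
isMinimumLabel : List ℕ → Layer → ℕ × ℕ → Bool
isMinimumLabel S p sm = memᵇ (proj₂ sm) S ∧ (proj₂ sm ≤ᵇ proj₁ sm) ∧ (lab S p (proj₂ sm) ≡ᵇ proj₂ sm)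

zip-map : (g : ℕ → ℕ) (S : List ℕ) → zip S (map g S) ≡ map (λ s → s , g s) S
zip-map g [] = refl
zip-map g (x ∷ S) = cong ((x , g x) ∷_) (zip-map g S)

zip-labels : ∀ {S p} → Unique S → length p ≡ length S → zip S p ≡ map (λ s → s , lab S p s) S
zip-labels {S} {p} uS len = trans (cong (zip S) (sym (map∘lab uS len))) (zip-map (lab S p) S)

labelChecks⇔ : ∀ {S p} → Unique S → length p ≡ length S →
  T (all (isMinimumLabel S p) (zip S p)) ⇔ All (λ s → T (isMinimumLabel S p (s , lab S p s))) S
labelChecks⇔ {S} {p} uS len = mk⇔
  (λ h → Allₚ.map⁻ (subst (All (T ∘ isMinimumLabel S p)) (zip-labels uS len) (Allₚ.all⁺ _ _ h)))
  (λ a → Allₚ.all⁻ _ (subst (All (T ∘ isMinimumLabel S p)) (sym (zip-labels uS len)) (Allₚ.map⁺ a)))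

isMinimumLabel⇔ : ∀ {S p s m} → T (isMinimumLabel S p (s , m)) ⇔ (m ∈ S × m ≤ s × lab S p m ≡ m)
isMinimumLabel⇔ {S} {p} {s} {m} = mk⇔
  (λ h → let m∈S , rest = to (T-∧ {memᵇ m S}) h ; m≤s , fixed = to (T-∧ {m ≤ᵇ s}) rest
         in to T-memᵇ⇔ m∈S , ℕ.≤ᵇ⇒≤ m s m≤s , to T-≡ᵇ⇔ fixed)
  (λ (m∈S , m≤s , fixed) → from T-∧ (from T-memᵇ⇔ m∈S , from T-∧ (ℕ.≤⇒≤ᵇ m≤s , from T-≡ᵇ⇔ fixed)))

isPart⇒IsPartition : ∀ {S p} → Unique S → T (isPart S p) → IsPartition S p
isPart⇒IsPartition {S} {p} uS h = record
  { length≡  = len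
  ; lab∈S    = proj₁ ∘ check
  ; lab≤     = proj₁ ∘ proj₂ ∘ check
  ; lab-idem = proj₂ ∘ proj₂ ∘ check
  }
  where
  len : length p ≡ length S
  len = to T-≡ᵇ⇔ (proj₁ (to (T-∧ {length p ≡ᵇ length S}) h))
  check : ∀ {s} → s ∈ S → lab S p s ∈ S × lab S p s ≤ s × lab S p (lab S p s) ≡ lab S p s
  check s∈S = to isMinimumLabel⇔ (All.lookup (to (labelChecks⇔ uS len) (proj₂ (to (T-∧ {length p ≡ᵇ length S}) h))) s∈S)

IsPartition⇒isPart : ∀ {S p} → Unique S → IsPartition S p → T (isPart S p)
IsPartition⇒isPart {S} {p} uS P = from T-∧ (from T-≡ᵇ⇔ length≡ , from (labelChecks⇔ uS length≡)
  (All.tabulate λ s∈S → from isMinimumLabel⇔ (lab∈S s∈S , lab≤ s∈S , lab-idem s∈S)))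
  where open IsPartition P

Refines : List ℕ → Layer → Layer → Set
Refines S p q = ∀ {s t} → s ∈ S → t ∈ S → lab S p s ≡ lab S p t → lab S q s ≡ lab S q t

refinesᵇ⇒Refines : ∀ {S p q} → T (refinesᵇ S p q) → Refines S p q
refinesᵇ⇒Refines {S} h s∈S t∈S eq with to T-∨ (All.lookup (Allₚ.all⁺ _ S (All.lookup (Allₚ.all⁺ _ S h) s∈S)) t∈S)
... | inj₁ different = ⊥-elim (subst (T ∘ not) (≡ᵇ-true eq) different)
... | inj₂ same = to T-≡ᵇ⇔ same

Refines⇒refinesᵇ : ∀ {S p q} → Refines S p q → T (refinesᵇ S p q)
Refines⇒refinesᵇ {S} {p} {q} R = Allₚ.all⁻ _ (All.tabulate λ s∈S → Allₚ.all⁻ _ (All.tabulate λ t∈S → check s∈S t∈S))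
  where
  check : ∀ {s t} → s ∈ S → t ∈ S → T (not (lab S p s ≡ᵇ lab S p t) ∨ (lab S q s ≡ᵇ lab S q t))
  check {s} {t} s∈S t∈S with lab S p s ℕ.≟ lab S p t
  ... | yes eq rewrite ≡ᵇ-true eq = from T-≡ᵇ⇔ (R s∈S t∈S eq)
  ... | no neq rewrite ≡ᵇ-false neq = tt

isWP⇔ : ∀ {k} S (π : WP k) → T (isWP S π) ⇔ (T (allParts S π) × T (chainRef S π))
isWP⇔ S π = T-∧ {allParts S π}

allParts-∷⇔ : ∀ {k} S p (π : WP k) → T (allParts S (p ∷ π)) ⇔ (T (isPart S p) × T (allParts S π))
allParts-∷⇔ S p π = T-∧ {isPart S p}

chainRef-∷∷⇔ : ∀ {k} S p q (π : WP k) → T (chainRef S (p ∷ q ∷ π)) ⇔ (T (refinesᵇ S q p) × T (chainRef S (q ∷ π)))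
chainRef-∷∷⇔ S p q π = T-∧ {refinesᵇ S q p}

allParts⁻ : ∀ {k} S (π : WP k) → T (allParts S π) → ∀ i → T (isPart S (lookup π i))
allParts⁻ S (p ∷ π) h zero    = proj₁ (to (allParts-∷⇔ S p π) h)
allParts⁻ S (p ∷ π) h (suc i) = allParts⁻ S π (proj₂ (to (allParts-∷⇔ S p π) h)) i

allParts⁺ : ∀ {k} S (π : WP k) → (∀ i → T (isPart S (lookup π i))) → T (allParts S π)
allParts⁺ S []      h = tt
allParts⁺ S (p ∷ π) h = from (allParts-∷⇔ S p π) (h zero , allParts⁺ S π (h ∘ suc))

isWP⇒IsPartition : ∀ {k S} (π : WP k) → Unique S → T (isWP S π) → ∀ i → IsPartition S (lookup π i)
isWP⇒IsPartition {S = S} π uS h i = isPart⇒IsPartition uS (allParts⁻ S π (proj₁ (to (isWP⇔ S π) h)) i)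

chainRef⇒Refines-head : ∀ {k} S p (π : WP k) → T (chainRef S (p ∷ π)) → ∀ i → Refines S (lookup (p ∷ π) i) p
chainRef⇒Refines-head S p π       h zero    _ _ eq = eq
chainRef⇒Refines-head S p (q ∷ π) h (suc i) s∈S t∈S =
  refinesᵇ⇒Refines (proj₁ (to (chainRef-∷∷⇔ S p q π) h)) s∈S t∈S
  ∘ chainRef⇒Refines-head S q π (proj₂ (to (chainRef-∷∷⇔ S p q π) h)) i s∈S t∈S

isWP⇒Refines-layer1 : ∀ {k S p} {π : WP k} → T (isWP S (p ∷ π)) → ∀ i → Refines S (lookup (p ∷ π) i) p
isWP⇒Refines-layer1 {S = S} {p} {π} h = chainRef⇒Refines-head S p π (proj₂ (to (isWP⇔ S (p ∷ π)) h))

chainRef-map : ∀ {k} S C (r : Layer → Layer) →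
  (∀ {p q} → T (refinesᵇ S q p) → T (refinesᵇ C (r q) (r p))) →
  (π : WP k) → T (chainRef S π) → T (chainRef C (Vec.map r π))
chainRef-map S C r R []          h = tt
chainRef-map S C r R (p ∷ [])    h = tt
chainRef-map S C r R (p ∷ q ∷ π) h = from (chainRef-∷∷⇔ C (r p) (r q) (Vec.map r π))
  (R (proj₁ (to (chainRef-∷∷⇔ S p q π) h)) , chainRef-map S C r R (q ∷ π) (proj₂ (to (chainRef-∷∷⇔ S p q π) h)))

isWP-map : ∀ {k} S C (r : Layer → Layer) (π : WP k) →
  (∀ i → T (isPart C (r (lookup π i)))) →
  (∀ {p q} → T (refinesᵇ S q p) → T (refinesᵇ C (r q) (r p))) →
  T (isWP S π) → T (isWP C (Vec.map r π))
isWP-map S C r π parts R h = from (isWP⇔ C (Vec.map r π))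
  ( allParts⁺ C (Vec.map r π) (λ i → subst (T ∘ isPart C) (sym (Vec.lookup-map i r π)) (parts i))
  , chainRef-map S C r R π (proj₂ (to (isWP⇔ S π) h)) )

chainRef-zipWith : ∀ {k} S C D (g : Layer → Layer → Layer) →
  (∀ {p q p′ q′} → T (isPart C p′) → T (isPart D q′) → T (refinesᵇ C p′ p) → T (refinesᵇ D q′ q) →
     T (refinesᵇ S (g p′ q′) (g p q))) →
  (a b : WP k) → T (allParts C a) → T (allParts D b) → T (chainRef C a) → T (chainRef D b) →
  T (chainRef S (zipWith g a b))
chainRef-zipWith S C D g R []           []           _ _ _ _ = tt
chainRef-zipWith S C D g R (p ∷ [])     (q ∷ [])     _ _ _ _ = tt
chainRef-zipWith S C D g R (p ∷ p′ ∷ a) (q ∷ q′ ∷ b) pa pb ca cb =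
  from (chainRef-∷∷⇔ S (g p q) (g p′ q′) (zipWith g a b))
  ( R (proj₁ (to (allParts-∷⇔ C p′ a) pa′)) (proj₁ (to (allParts-∷⇔ D q′ b) pb′)) (proj₁ ca′) (proj₁ cb′)
  , chainRef-zipWith S C D g R (p′ ∷ a) (q′ ∷ b) pa′ pb′ (proj₂ ca′) (proj₂ cb′) )
  where
  pa′ : T (allParts C (p′ ∷ a))
  pa′ = proj₂ (to (allParts-∷⇔ C p (p′ ∷ a)) pa)
  pb′ : T (allParts D (q′ ∷ b))
  pb′ = proj₂ (to (allParts-∷⇔ D q (q′ ∷ b)) pb)
  ca′ : T (refinesᵇ C p′ p) × T (chainRef C (p′ ∷ a))
  ca′ = to (chainRef-∷∷⇔ C p p′ a) ca
  cb′ : T (refinesᵇ D q′ q) × T (chainRef D (q′ ∷ b))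
  cb′ = to (chainRef-∷∷⇔ D q q′ b) cb

isWP-zipWith : ∀ {k} S C D (g : Layer → Layer → Layer) (a b : WP k) →
  (∀ i → T (isPart S (g (lookup a i) (lookup b i)))) →
  (∀ {p q p′ q′} → T (isPart C p′) → T (isPart D q′) → T (refinesᵇ C p′ p) → T (refinesᵇ D q′ q) →
     T (refinesᵇ S (g p′ q′) (g p q))) →
  T (isWP C a) → T (isWP D b) → T (isWP S (zipWith g a b))
isWP-zipWith S C D g a b parts R ha hb = from (isWP⇔ S (zipWith g a b))
  ( allParts⁺ S (zipWith g a b) (λ i → subst (T ∘ isPart S) (sym (Vec.lookup-zipWith g i a b)) (parts i))
  , chainRef-zipWith S C D g R a b (proj₁ ha′) (proj₁ hb′) (proj₂ ha′) (proj₂ hb′) )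
  where
  ha′ : T (allParts C a) × T (chainRef C a)
  ha′ = to (isWP⇔ C a) ha
  hb′ : T (allParts D b) × T (chainRef D b)
  hb′ = to (isWP⇔ D b) hb

isWP-zeroWP : ∀ {k S} → Unique S → T (isWP S (zeroWP {k} S))
isWP-zeroWP {k} {S} uS = from (isWP⇔ S (zeroWP {k} S)) (allParts⁺ S (zeroWP {k} S) singletons , chain k)
  where
  singletons : ∀ i → T (isPart S (lookup (zeroWP {k} S) i))
  singletons i rewrite Vec.lookup∘tabulate (λ _ → S) i = IsPartition⇒isPart uS record
    { length≡  = refl
    ; lab∈S    = λ {s} s∈S → subst (_∈ S) (sym (lab-self S s)) s∈S
    ; lab≤     = λ {s} _ → ℕ.≤-reflexive (lab-self S s)
    ; lab-idem = λ {s} _ → lab-self S (lab S S s)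
    }
  chain : ∀ k → T (chainRef S (zeroWP {k} S))
  chain zero          = tt
  chain (suc zero)    = tt
  chain (suc (suc k)) = from (chainRef-∷∷⇔ S S S (zeroWP {k} S)) (Refines⇒refinesᵇ {S} {S} {S} (λ _ _ eq → eq) , chain (suc k))

concatMap≡cartesianProductWith : {A B C : Set} (f : A → B → C) (xs : List A) (ys : List B) →
  concatMap (λ x → map (f x) ys) xs ≡ cartesianProductWith f xs ys
concatMap≡cartesianProductWith f []       ys = refl
concatMap≡cartesianProductWith f (x ∷ xs) ys = cong (map (f x) ys ++_) (concatMap≡cartesianProductWith f xs ys)

allLists-unique : ∀ n {xs : List ℕ} → Unique xs → Unique (allLists n xs)
allLists-unique zero    _  = [] ∷ []
allLists-unique (suc n) {xs} ux rewrite concatMap≡cartesianProductWith Data.List._∷_ xs (allLists n xs) =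
  Unique.cartesianProductWith⁺ Data.List._∷_ List.∷-injective ux (allLists-unique n ux)

allLists-complete : ∀ {xs : List ℕ} (p : List ℕ) → (∀ {m} → m ∈ p → m ∈ xs) → p ∈ allLists (length p) xs
allLists-complete []      _ = here refl
allLists-complete {xs} (m ∷ p) p⊆xs rewrite concatMap≡cartesianProductWith Data.List._∷_ xs (allLists (length p) xs) =
  ∈-cartesianProductWith⁺ _∷_ (p⊆xs (here refl)) (allLists-complete p (p⊆xs ∘ there))

allVecs-unique : ∀ {A : Set} k {xs : List A} → Unique xs → Unique (allVecs k xs)
allVecs-unique zero    _  = [] ∷ []
allVecs-unique (suc k) {xs} ux rewrite concatMap≡cartesianProductWith Data.Vec._∷_ xs (allVecs k xs) =
  Unique.cartesianProductWith⁺ Data.Vec._∷_ Vec.∷-injective ux (allVecs-unique k ux)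

allVecs-complete : ∀ {A : Set} {k} {xs : List A} (v : Vec A k) → (∀ i → lookup v i ∈ xs) → v ∈ allVecs k xs
allVecs-complete []      _ = here refl
allVecs-complete {k = suc k} {xs} (x ∷ v) v⊆xs rewrite concatMap≡cartesianProductWith Data.Vec._∷_ xs (allVecs k xs) =
  ∈-cartesianProductWith⁺ _∷_ (v⊆xs zero) (allVecs-complete v (v⊆xs ∘ suc))

parts-complete : ∀ {S p} → Unique S → T (isPart S p) → p ∈ parts S
parts-complete {S} {p} uS h =
  from (∈-filterᵇ⇔ (isPart S) _) (subst (λ n → p ∈ allLists n S) length≡ (allLists-complete p labels∈S) , h)
  where
  open IsPartition (isPart⇒IsPartition uS h)
  labels∈S : ∀ {m} → m ∈ p → m ∈ S
  labels∈S {m} m∈p with ∈-map⁻ (lab S p) (subst (m ∈_) (sym (map∘lab uS length≡)) m∈p)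
  ... | s , s∈S , refl = lab∈S s∈S

enumWP-complete : ∀ {k S} {π : WP k} → Unique S → T (isWP S π) → π ∈ enumWP k S
enumWP-complete {S = S} {π} uS h = from (∈-filterᵇ⇔ (isWP S) _)
  (allVecs-complete π (λ i → parts-complete uS (allParts⁻ S π (proj₁ (to (isWP⇔ S π) h)) i)) , h)

enumWP-sound : ∀ {k S} {π : WP k} → π ∈ enumWP k S → T (isWP S π)
enumWP-sound {k} {S} = proj₂ ∘ to (∈-filterᵇ⇔ (isWP S) (allVecs k (parts S)))

enumWP-unique : ∀ k {S} → Unique S → Unique (enumWP k S)
enumWP-unique k {S} uS = filterᵇ-unique (isWP S) (allVecs-unique k (filterᵇ-unique (isPart S) (allLists-unique (length S) uS)))

-- Antisymmetry of the order

Leq⇒isWP : ∀ {k S} {x y : WP k} → Leq S x y → T (isWP S y) → T (isWP S x)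
Leq⇒isWP ε                                   hy = hy
Leq⇒isWP (cover _ _ _ hx _ _ _ _ _ _ _ ◅ _) _  = hx

-- mergeLayer S p α β is definitionally map (merge (lab S p α) (lab S p β)) p.
merge : ℕ → ℕ → ℕ → ℕ
merge a b m = if (m ≡ᵇ a) ∨ (m ≡ᵇ b) then a ⊓ b else m

merge-left : ∀ a b → merge a b a ≡ a ⊓ b
merge-left a b rewrite ≡ᵇ-true (refl {x = a}) = refl

merge-right : ∀ a b → merge a b b ≡ a ⊓ b
merge-right a b rewrite ≡ᵇ-true (refl {x = b}) with b ≡ᵇ a
... | true  = refl
... | false = refl

merge-other : ∀ {a b m} → m ≢ a → m ≢ b → merge a b m ≡ m
merge-other m≢a m≢b rewrite ≡ᵇ-false m≢a | ≡ᵇ-false m≢b = refl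

merge-≤ : ∀ a b m → merge a b m ≤ m
merge-≤ a b m with m ℕ.≟ a | m ℕ.≟ b
... | yes refl | _       rewrite ≡ᵇ-true (refl {x = m}) = ℕ.m⊓n≤m m b
... | no m≢a   | yes refl rewrite ≡ᵇ-false m≢a | ≡ᵇ-true (refl {x = m}) = ℕ.m⊓n≤n a m
... | no m≢a   | no m≢b  = ℕ.≤-reflexive (merge-other m≢a m≢b)

sum-map-≤ : (f : ℕ → ℕ) → (∀ m → f m ≤ m) → (p : List ℕ) → sum (map f p) ≤ sum p
sum-map-≤ f f≤ []      = z≤n
sum-map-≤ f f≤ (x ∷ p) = ℕ.+-mono-≤ (f≤ x) (sum-map-≤ f f≤ p)

sum-map-< : (f : ℕ → ℕ) → (∀ m → f m ≤ m) → ∀ {e p} → e ∈ p → f e < e → sum (map f p) < sum p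
sum-map-< f f≤ {p = x ∷ p} (here refl) fe<e = ℕ.+-mono-<-≤ fe<e (sum-map-≤ f f≤ p)
sum-map-< f f≤ {p = x ∷ p} (there e∈p) fe<e = ℕ.+-mono-≤-< (f≤ x) (sum-map-< f f≤ e∈p fe<e)

sum-merge-< : ∀ {a b p} → a ≢ b → a ∈ p → b ∈ p → sum (map (merge a b) p) < sum p
sum-merge-< {a} {b} a≢b a∈p b∈p with ℕ.<-cmp a b
... | tri< a<b _ _ = sum-map-< (merge a b) (merge-≤ a b) b∈p
  (subst (_< b) (sym (trans (merge-right a b) (ℕ.m≤n⇒m⊓n≡m (ℕ.<⇒≤ a<b)))) a<b)
... | tri≈ _ a≡b _ = contradiction a≡b a≢b
... | tri> _ _ b<a = sum-map-< (merge a b) (merge-≤ a b) a∈p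
  (subst (_< a) (sym (trans (merge-left a b) (ℕ.m≥n⇒m⊓n≡n (ℕ.<⇒≤ b<a)))) b<a)

weight : ∀ {k} → List ℕ → WP k → ℕ
weight S π = sum (layer1 S π)

Cover⇒weight< : ∀ {k S} {x y : WP k} → Unique S → Cover S x y → weight S y < weight S x
Cover⇒weight< {x = x@(p ∷ _)} uS (cover α β _ hx α∈S β∈S _ different _ _ refl) =
  sum-merge-< different (lab∈ length≡ α∈S) (lab∈ length≡ β∈S)
  where open IsPartition (isWP⇒IsPartition x uS hx zero)

Leq⇒weight≤ : ∀ {k S} {x y : WP k} → Unique S → Leq S x y → weight S y ≤ weight S x
Leq⇒weight≤ uS ε         = ℕ.≤-refl
Leq⇒weight≤ uS (c ◅ x≤y) = ℕ.≤-trans (Leq⇒weight≤ uS x≤y) (ℕ.<⇒≤ (Cover⇒weight< uS c))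

Leq-antisym : ∀ {k S} {x y : WP k} → Unique S → Leq S x y → Leq S y x → x ≡ y
Leq-antisym uS ε         _   = refl
Leq-antisym uS (c ◅ x≤y) y≤x =
  contradiction (Leq⇒weight≤ uS y≤x) (ℕ.<⇒≱ (ℕ.≤-<-trans (Leq⇒weight≤ uS x≤y) (Cover⇒weight< uS c)))

-- The Möbius function

T-does⇔ : {P : Set} (d : Dec P) → T (does d) ⇔ P
T-does⇔ (yes p) = mk⇔ (λ _ → p) (λ _ → tt)
T-does⇔ (no ¬p) = mk⇔ (λ ()) ¬p

length-filterᵇ-≤ : {X : Set} (p q : X → Bool) (L : List X) → (∀ {w} → w ∈ L → T (p w) → T (q w)) →
  length (filterᵇ p L) ≤ length (filterᵇ q L)
length-filterᵇ-≤ p q []      p⇒q = z≤n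
length-filterᵇ-≤ p q (x ∷ L) p⇒q with p x in px | q x in qx | length-filterᵇ-≤ p q L (p⇒q ∘ there)
... | true  | true  | rest = s≤s rest
... | false | true  | rest = ℕ.m≤n⇒m≤1+n rest
... | false | false | rest = rest
... | true  | false | _    = ⊥-elim (subst T qx (p⇒q (here refl) (subst T (sym px) tt)))

length-filterᵇ-< : {X : Set} (p q : X → Bool) (L : List X) → (∀ {w} → w ∈ L → T (p w) → T (q w)) →
  ∀ {z} → z ∈ L → T (q z) → ¬ T (p z) → length (filterᵇ p L) < length (filterᵇ q L)
length-filterᵇ-< p q (x ∷ L) p⇒q {z} (here refl) qz ¬pz with p z | q z
... | true  | _     = contradiction tt ¬pz
... | false | false = ⊥-elim qz
... | false | true  = s≤s (length-filterᵇ-≤ p q L (p⇒q ∘ there))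
length-filterᵇ-< p q (x ∷ L) p⇒q (there z∈L) qz ¬pz
  with p x in px | q x in qx | length-filterᵇ-< p q L (p⇒q ∘ there) z∈L qz ¬pz
... | true  | true  | rest = s≤s rest
... | false | true  | rest = ℕ.m<n⇒m<1+n rest
... | false | false | rest = rest
... | true  | false | _    = ⊥-elim (subst T qx (p⇒q (here refl) (subst T (sym px) tt)))

module Möbius (dec : LeqDec) (k : ℕ) {S : List ℕ} (uS : Unique S) where

  E : List (WP k)
  E = enumWP k S

  between : WP k → WP k → WP k → Bool
  between x y z = does (dec S x z) ∧ does (dec S z y)

  -- x ≤ z < y, written exactly as the summation condition of μfuel
  below : WP k → WP k → WP k → Bool
  below x y z = does (dec S x z) ∧ does (dec S z y) ∧ not (does (z ≟WP y))

  between⇔ : ∀ {x y z} → T (between x y z) ⇔ (Leq S x z × Leq S z y)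
  between⇔ {x} {y} {z} = mk⇔
    (λ h → let x≤z , z≤y = to (T-∧ {does (dec S x z)}) h in to (T-does⇔ (dec S x z)) x≤z , to (T-does⇔ (dec S z y)) z≤y)
    (λ (x≤z , z≤y) → from T-∧ (from (T-does⇔ (dec S x z)) x≤z , from (T-does⇔ (dec S z y)) z≤y))

  interval : WP k → WP k → List (WP k)
  interval x y = filterᵇ (between x y) E

  ∈interval⇔ : ∀ {x y z} → z ∈ interval x y ⇔ (z ∈ E × Leq S x z × Leq S z y)
  ∈interval⇔ {x} {y} = mk⇔ (λ z∈I → let z∈E , b = to (∈-filterᵇ⇔ (between x y) E) z∈I in z∈E , to between⇔ b)
                           (λ (z∈E , x≤z , z≤y) → from (∈-filterᵇ⇔ (between x y) E) (z∈E , from between⇔ (x≤z , z≤y)))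

  below⇔ : ∀ {x y z} → T (below x y z) ⇔ (Leq S x z × Leq S z y × z ≢ y)
  below⇔ {x} {y} {z} = mk⇔
    (λ h → let x≤z , rest = to (T-∧ {does (dec S x z)}) h ; z≤y , z≢y = to (T-∧ {does (dec S z y)}) rest
           in to (T-does⇔ (dec S x z)) x≤z , to (T-does⇔ (dec S z y)) z≤y , λ z≡y → subst T (to T-not-≡ z≢y) (from T-≡ (dec-true (z ≟WP y) z≡y)))
    (λ (x≤z , z≤y , z≢y) → from T-∧ (from (T-does⇔ (dec S x z)) x≤z ,
      from T-∧ (from (T-does⇔ (dec S z y)) z≤y , from T-not-≡ (dec-false (z ≟WP y) z≢y))))

  count : WP k → WP k → ℕ
  count x y = length (filterᵇ (below x y) E)

  count-decreases : ∀ {x y z} → z ∈ E → T (below x y z) → count x z < count x y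
  count-decreases {x} {y} {z} z∈E xzy = length-filterᵇ-< (below x z) (below x y) E below-mono z∈E xzy ¬xzz
    where
    z≤y : Leq S z y
    z≤y = proj₁ (proj₂ (to below⇔ xzy))
    ¬xzz : ¬ T (below x z z)
    ¬xzz h = proj₂ (proj₂ (to below⇔ h)) refl
    below-mono : ∀ {w} → w ∈ E → T (below x z w) → T (below x y w)
    below-mono _ h with to below⇔ h
    ... | x≤w , w≤z , w≢z = from below⇔ (x≤w , w≤z ◅◅ z≤y , λ { refl → w≢z (Leq-antisym uS w≤z z≤y) })

  count<size : ∀ {x y} → y ∈ E → count x y < length E
  count<size {x} {y} y∈E = List.filter-notAll (T? ∘ below x y) E
    (Any.map (λ { refl h → proj₂ (proj₂ (to below⇔ h)) refl }) y∈E)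

  μfuel-stable : ∀ f f′ {x y} → count x y < f → count x y < f′ → μfuel f dec S x y ≡ μfuel f′ dec S x y
  μfuel-stable (suc f) (suc f′) {x} {y} c<f c<f′ with does (x ≟WP y)
  ... | true  = refl
  ... | false = cong -_ (sumIf-cong E (λ _ → refl) λ {z} z∈E xzy →
    μfuel-stable f f′ (ℕ.<-≤-trans (count-decreases z∈E xzy) (ℕ.≤-pred c<f))
                      (ℕ.<-≤-trans (count-decreases z∈E xzy) (ℕ.≤-pred c<f′)))

  μ-refl : ∀ (x : WP k) → μ dec S x x ≡ 1ℤ
  μ-refl x with x ≟WP x
  ... | yes _   = refl
  ... | no x≢x = contradiction refl x≢x

  μ-unfold : ∀ {x y} → x ≢ y → y ∈ E → μ dec S x y ≡ - sumIf E (below x y) (μ dec S x)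
  μ-unfold {x} {y} x≢y y∈E with x ≟WP y
  ... | yes x≡y = contradiction x≡y x≢y
  ... | no _    = cong -_ (sumIf-cong E (λ _ → refl) λ z∈E xzy →
    let z<size = ℕ.<-trans (count-decreases z∈E xzy) (count<size y∈E)
    in μfuel-stable (length E) (suc (length E)) z<size (ℕ.m<n⇒m<1+n z<size))

  μ-incomparable : ∀ {x y} → ¬ Leq S x y → μ dec S x y ≡ 0ℤ
  μ-incomparable {x} {y} x≰y with x ≟WP y
  ... | yes refl = contradiction ε x≰y
  ... | no _     = cong -_ (sumIf-none E _ λ _ h → let x≤z , z≤y , _ = to below⇔ h in x≰y (x≤z ◅◅ z≤y))

  sumIf-between : ∀ {x y} (g : WP k → ℤ) → Leq S x y → y ∈ E →
    sumIf E (between x y) g ≡ g y + sumIf E (below x y) g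
  sumIf-between {x} {y} g x≤y y∈E =
    trans (sumIf-extract _≟WP_ (enumWP-unique k uS) g y∈E (from between⇔ (x≤y , ε)))
          (cong (g y +_) (sumIf-cong E (λ {z} _ → ∧-assoc (does (dec S x z)) _ _) (λ _ _ → refl)))

  sum-μ-≢ : ∀ {x y} → x ≢ y → Leq S x y → y ∈ E → sumIf E (between x y) (μ dec S x) ≡ 0ℤ
  sum-μ-≢ {x} {y} x≢y x≤y y∈E = begin
    sumIf E (between x y) (μ dec S x)                  ≡⟨ sumIf-between (μ dec S x) x≤y y∈E ⟩
    μ dec S x y + Σbelow                               ≡⟨ cong (_+ Σbelow) (μ-unfold x≢y y∈E) ⟩
    - Σbelow + Σbelow                                   ≡⟨ ℤ.+-inverseˡ Σbelow ⟩
    0ℤ ∎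
    where
    open ≡-Reasoning
    Σbelow : ℤ
    Σbelow = sumIf E (below x y) (μ dec S x)

  μ-unique : (G : WP k → ℤ) {x Y : WP k} → T (isWP S Y) → G x ≡ 1ℤ →
    (∀ {y} → x ≢ y → Leq S x y → Leq S y Y → sumIf E (between x y) G ≡ 0ℤ) →
    ∀ {y} → Leq S x y → Leq S y Y → μ dec S x y ≡ G y
  μ-unique G {x} {Y} hY Gx≡1 sum≡0 {y} x≤y y≤Y = go (suc (count x y)) ℕ.≤-refl x≤y y≤Y
    where
    go : ∀ n {y} → count x y < n → Leq S x y → Leq S y Y → μ dec S x y ≡ G y
    go (suc n) {y} c<n x≤y y≤Y = step (x ≟WP y)
      where
      step : Dec (x ≡ y) → μ dec S x y ≡ G y
      step (yes refl) = trans (μ-refl x) (sym Gx≡1)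
      step (no x≢y) = begin
        μ dec S x y                          ≡⟨ μ-unfold x≢y y∈E ⟩
        - sumIf E (below x y) (μ dec S x)    ≡⟨ cong -_ (sumIf-cong E (λ _ → refl) induction) ⟩
        - sumIf E (below x y) G              ≡⟨ sym (inverseˡ-unique (G y) _ sum-below) ⟩
        G y                                  ∎
        where
        open ≡-Reasoning
        y∈E : y ∈ E
        y∈E = enumWP-complete uS (Leq⇒isWP y≤Y hY)
        induction : ∀ {z} → z ∈ E → T (below x y z) → μ dec S x z ≡ G z
        induction z∈E xzy = let x≤z , z≤y , _ = to below⇔ xzy in
          go n (ℕ.<-≤-trans (count-decreases z∈E xzy) (ℕ.≤-pred c<n)) x≤z (z≤y ◅◅ y≤Y)
        sum-below : G y + sumIf E (below x y) G ≡ 0ℤ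
        sum-below = trans (sym (sumIf-between G x≤y y∈E)) (sum≡0 x≢y x≤y y≤Y)

-- Splitting along a union of blocks

lookup-extensionality : ∀ {A : Set} {n} {v w : Vec A n} → (∀ i → lookup v i ≡ lookup w i) → v ≡ w
lookup-extensionality {v = v} {w} v≗w = trans (sym (Vec.tabulate∘lookup v)) (trans (Vec.tabulate-cong v≗w) (Vec.tabulate∘lookup w))

lookup-restrict : ∀ {k} S (z : WP k) B i → lookup (restrict S z B) i ≡ map (lab S (lookup z i)) B
lookup-restrict S z B i = Vec.lookup-map i _ z

lookup-mergeWP : ∀ {k} S (z : WP k) α β l i →
  lookup (mergeWP S z α β l) i ≡ (if toℕ i ≤ᵇ toℕ l then mergeLayer S (lookup z i) α β else lookup z i)
lookup-mergeWP S z α β l i = Vec.lookup∘tabulate _ i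

restrict-zeroWP : ∀ {k} S B → restrict S (zeroWP {k} S) B ≡ zeroWP {k} B
restrict-zeroWP S B = lookup-extensionality λ i → begin
  lookup (restrict S (zeroWP S) B) i   ≡⟨ lookup-restrict S (zeroWP S) B i ⟩
  map (lab S (lookup (zeroWP S) i)) B  ≡⟨ cong (λ p → map (lab S p) B) (Vec.lookup∘tabulate (λ _ → S) i) ⟩
  map (lab S S) B                      ≡⟨ trans (List.map-cong (lab-self S) B) (List.map-id B) ⟩
  B                                    ≡⟨ Vec.lookup∘tabulate (λ _ → B) i ⟨
  lookup (zeroWP B) i                  ∎
  where open ≡-Reasoning

Refines-restrict : ∀ {S} (B : List ℕ) → (∀ {t} → t ∈ B → t ∈ S) → ∀ {p q} → Refines S p q →
  Refines B (map (lab S p) B) (map (lab S q) B)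
Refines-restrict {S} B B⊆S {p} {q} R s∈B t∈B eq =
  trans (lab∘map (lab S q) s∈B)
    (trans (R (B⊆S s∈B) (B⊆S t∈B) (trans (sym (lab∘map (lab S p) s∈B)) (trans eq (lab∘map (lab S p) t∈B))))
           (sym (lab∘map (lab S q) t∈B)))

restrict-restrict : ∀ {k} S (π : WP k) {D B} → (∀ {t} → t ∈ B → t ∈ D) → restrict D (restrict S π D) B ≡ restrict S π B
restrict-restrict S π {D} {B} B⊆D = trans (sym (Vec.map-∘ _ _ π))
  (Vec.map-cong (λ q → List.map-cong-local (All.tabulate (lab∘map (lab S q) ∘ B⊆D))) π)

record Splitting (S : List ℕ) : Set where
  field
    side         : ℕ → Bool
    left right   : List ℕ
    left-unique  : Unique left
    right-unique : Unique right
    ∈left⇔       : ∀ {t} → t ∈ left ⇔ (t ∈ S × T (side t))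
    ∈right⇔      : ∀ {t} → t ∈ right ⇔ (t ∈ S × T (not (side t)))

swap : ∀ {S} → Splitting S → Splitting S
swap σ = record
  { side = not ∘ side ; left = right ; right = left
  ; left-unique = right-unique ; right-unique = left-unique
  ; ∈left⇔ = ∈right⇔
  ; ∈right⇔ = λ {t} → subst (λ b → t ∈ left ⇔ (t ∈ _ × T b)) (sym (not-involutive (side t))) ∈left⇔
  }
  where open Splitting σ

module Gluing {S : List ℕ} (uS : Unique S) (σ : Splitting S) where

  open Splitting σ

  -- every block of every layer of z lies on one side
  Compatible : ∀ {k} → WP k → Set
  Compatible z = ∀ i {t} → t ∈ S → side (lab S (lookup z i) t) ≡ side t

  glueLayer : Layer → Layer → Layer
  glueLayer p q = map (λ s → if side s then lab left p s else lab right q s) S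

  glue : ∀ {k} → WP k → WP k → WP k
  glue = zipWith glueLayer

  left⊆S : ∀ {t} → t ∈ left → t ∈ S
  left⊆S = proj₁ ∘ to ∈left⇔

  right⊆S : ∀ {t} → t ∈ right → t ∈ S
  right⊆S = proj₁ ∘ to ∈right⇔

  side-left : ∀ {t} → t ∈ left → side t ≡ true
  side-left = to T-≡ ∘ proj₂ ∘ to ∈left⇔

  side-right : ∀ {t} → t ∈ right → side t ≡ false
  side-right = to T-not-≡ ∘ proj₂ ∘ to ∈right⇔

  left-or-right : ∀ {t} → t ∈ S → t ∈ left ⊎ t ∈ right
  left-or-right {t} t∈S with side t in st
  ... | true  = inj₁ (from ∈left⇔ (t∈S , from T-≡ st))
  ... | false = inj₂ (from ∈right⇔ (t∈S , from T-not-≡ st))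

  left≢right : ∀ {s t} → s ∈ left → t ∈ right → s ≢ t
  left≢right s∈C t∈D refl with trans (sym (side-left s∈C)) (side-right t∈D)
  ... | ()

  lab-glue-left : ∀ p q {t} → t ∈ left → lab S (glueLayer p q) t ≡ lab left p t
  lab-glue-left p q {t} t∈C rewrite lab∘map (λ s → if side s then lab left p s else lab right q s) (left⊆S t∈C)
                                  | side-left t∈C = refl

  lab-glue-right : ∀ p q {t} → t ∈ right → lab S (glueLayer p q) t ≡ lab right q t
  lab-glue-right p q {t} t∈D rewrite lab∘map (λ s → if side s then lab left p s else lab right q s) (right⊆S t∈D)
                                   | side-right t∈D = refl

  restrict-glue-left : ∀ {k} (a b : WP k) → T (isWP left a) → restrict S (glue a b) left ≡ a
  restrict-glue-left a b ha = lookup-extensionality λ i → begin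
    lookup (restrict S (glue a b) left) i                 ≡⟨ lookup-restrict S (glue a b) left i ⟩
    map (lab S (lookup (glue a b) i)) left                ≡⟨ cong (λ p → map (lab S p) left) (Vec.lookup-zipWith glueLayer i a b) ⟩
    map (lab S (glueLayer (lookup a i) (lookup b i))) left ≡⟨ List.map-cong-local (All.tabulate (lab-glue-left _ _)) ⟩
    map (lab left (lookup a i)) left                       ≡⟨ map∘lab left-unique (IsPartition.length≡ (isWP⇒IsPartition a left-unique ha i)) ⟩
    lookup a i                                             ∎
    where open ≡-Reasoning

  glue-restrict : ∀ {k} (z : WP k) → T (isWP S z) → glue (restrict S z left) (restrict S z right) ≡ z
  glue-restrict z hz = lookup-extensionality λ i → begin
    lookup (glue (restrict S z left) (restrict S z right)) i
      ≡⟨ Vec.lookup-zipWith glueLayer i (restrict S z left) _ ⟩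
    glueLayer (lookup (restrict S z left) i) (lookup (restrict S z right) i)
      ≡⟨ cong₂ glueLayer (lookup-restrict S z left i) (lookup-restrict S z right i) ⟩
    glueLayer (map (lab S (lookup z i)) left) (map (lab S (lookup z i)) right)
      ≡⟨ List.map-cong-local (All.tabulate (sides (lookup z i))) ⟩
    map (lab S (lookup z i)) S
      ≡⟨ map∘lab uS (IsPartition.length≡ (isWP⇒IsPartition z uS hz i)) ⟩
    lookup z i ∎
    where
    open ≡-Reasoning
    sides : ∀ p {s} → s ∈ S → (if side s then lab left (map (lab S p) left) s else lab right (map (lab S p) right) s) ≡ lab S p s
    sides p {s} s∈S with left-or-right s∈S
    ... | inj₁ s∈C rewrite side-left s∈C = lab∘map (lab S p) s∈C
    ... | inj₂ s∈D rewrite side-right s∈D = lab∘map (lab S p) s∈D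

  IsPartition-restrict-left : ∀ {p} → IsPartition S p → (∀ {t} → t ∈ S → side (lab S p t) ≡ side t) →
    IsPartition left (map (lab S p) left)
  IsPartition-restrict-left {p} P compatible = record
    { length≡  = List.length-map (lab S p) left
    ; lab∈S    = λ t∈C → subst (_∈ left) (sym (lab∘map (lab S p) t∈C)) (label∈C t∈C)
    ; lab≤     = λ t∈C → subst (_≤ _) (sym (lab∘map (lab S p) t∈C)) (lab≤ (left⊆S t∈C))
    ; lab-idem = λ {t} t∈C → begin
        lab left (map (lab S p) left) (lab left (map (lab S p) left) t) ≡⟨ cong (lab left _) (lab∘map (lab S p) t∈C) ⟩
        lab left (map (lab S p) left) (lab S p t)                       ≡⟨ lab∘map (lab S p) (label∈C t∈C) ⟩
        lab S p (lab S p t)                                             ≡⟨ lab-idem (left⊆S t∈C) ⟩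
        lab S p t                                                       ≡⟨ lab∘map (lab S p) t∈C ⟨
        lab left (map (lab S p) left) t                                 ∎
    }
    where
    open IsPartition P
    open ≡-Reasoning
    label∈C : ∀ {t} → t ∈ left → lab S p t ∈ left
    label∈C t∈C = from ∈left⇔ (lab∈S (left⊆S t∈C) , from T-≡ (trans (compatible (left⊆S t∈C)) (side-left t∈C)))

  isWP-restrict-left : ∀ {k} (z : WP k) → T (isWP S z) → Compatible z → T (isWP left (restrict S z left))
  isWP-restrict-left z hz compatible = isWP-map S left (λ p → map (lab S p) left) z
    (λ i → IsPartition⇒isPart left-unique (IsPartition-restrict-left (isWP⇒IsPartition z uS hz i) (compatible i)))
    (Refines⇒refinesᵇ ∘ Refines-restrict left left⊆S ∘ refinesᵇ⇒Refines)
    hz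

  IsPartition-glue : ∀ {p q} → IsPartition left p → IsPartition right q → IsPartition S (glueLayer p q)
  IsPartition-glue {p} {q} P Q = record
    { length≡  = List.length-map _ S
    ; lab∈S    = λ s∈S → by-side {R = _∈ S} s∈S (left⊆S ∘ P.lab∈S) (right⊆S ∘ Q.lab∈S)
    ; lab≤     = λ {s} s∈S → by-side {R = _≤ s} s∈S P.lab≤ Q.lab≤
    ; lab-idem = λ s∈S → by-side {R = λ m → lab S (glueLayer p q) m ≡ m} s∈S
        (λ s∈C → trans (lab-glue-left p q (P.lab∈S s∈C)) (P.lab-idem s∈C))
        (λ s∈D → trans (lab-glue-right p q (Q.lab∈S s∈D)) (Q.lab-idem s∈D))
    }
    where
    module P = IsPartition P
    module Q = IsPartition Q
    by-side : ∀ {s} {R : ℕ → Set} → s ∈ S →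
      (s ∈ left → R (lab left p s)) → (s ∈ right → R (lab right q s)) → R (lab S (glueLayer p q) s)
    by-side {R = R} s∈S onC onD with left-or-right s∈S
    ... | inj₁ s∈C = subst R (sym (lab-glue-left p q s∈C)) (onC s∈C)
    ... | inj₂ s∈D = subst R (sym (lab-glue-right p q s∈D)) (onD s∈D)

  Refines-glue : ∀ {p q p′ q′} → IsPartition left p′ → IsPartition right q′ →
    Refines left p′ p → Refines right q′ q → Refines S (glueLayer p′ q′) (glueLayer p q)
  Refines-glue {p} {q} {p′} {q′} P′ Q′ Rp Rq {s} {t} s∈S t∈S eq with left-or-right s∈S | left-or-right t∈S
  ... | inj₁ s∈C | inj₁ t∈C =
    trans (lab-glue-left p q s∈C) (trans (Rp s∈C t∈C (glued-left s∈C t∈C)) (sym (lab-glue-left p q t∈C)))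
    where
    glued-left : s ∈ left → t ∈ left → lab left p′ s ≡ lab left p′ t
    glued-left s∈C t∈C = trans (sym (lab-glue-left p′ q′ s∈C)) (trans eq (lab-glue-left p′ q′ t∈C))
  ... | inj₂ s∈D | inj₂ t∈D =
    trans (lab-glue-right p q s∈D) (trans (Rq s∈D t∈D glued-right) (sym (lab-glue-right p q t∈D)))
    where
    glued-right : lab right q′ s ≡ lab right q′ t
    glued-right = trans (sym (lab-glue-right p′ q′ s∈D)) (trans eq (lab-glue-right p′ q′ t∈D))
  ... | inj₁ s∈C | inj₂ t∈D = contradiction
    (trans (sym (lab-glue-left p′ q′ s∈C)) (trans eq (lab-glue-right p′ q′ t∈D)))
    (left≢right (IsPartition.lab∈S P′ s∈C) (IsPartition.lab∈S Q′ t∈D))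
  ... | inj₂ s∈D | inj₁ t∈C = contradiction
    (trans (sym (lab-glue-left p′ q′ t∈C)) (trans (sym eq) (lab-glue-right p′ q′ s∈D)))
    (left≢right (IsPartition.lab∈S P′ t∈C) (IsPartition.lab∈S Q′ s∈D))

  isWP-glue : ∀ {k} (a b : WP k) → T (isWP left a) → T (isWP right b) → T (isWP S (glue a b))
  isWP-glue a b ha hb = isWP-zipWith S left right glueLayer a b
    (λ i → IsPartition⇒isPart uS (IsPartition-glue (isWP⇒IsPartition a left-unique ha i) (isWP⇒IsPartition b right-unique hb i)))
    (λ p′ q′ rp rq → Refines⇒refinesᵇ (Refines-glue (isPart⇒IsPartition left-unique p′) (isPart⇒IsPartition right-unique q′)
                                                    (refinesᵇ⇒Refines rp) (refinesᵇ⇒Refines rq)))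
    ha hb

  Compatible-cover : ∀ {k} {z z′ : WP k} → Cover S z z′ → Compatible z′ → Compatible z
  Compatible-cover {z = z} {z′} (cover α β l hz _ _ _ _ _ _ refl) compatible′ i {t} t∈S =
    trans (sym (compatible′ i (lab∈S t∈S))) (trans (cong side merged-idem) (compatible′ i t∈S))
    where
    open IsPartition (isWP⇒IsPartition z uS hz i)
    merged-idem : lab S (lookup z′ i) (lab S (lookup z i) t) ≡ lab S (lookup z′ i) t
    merged-idem rewrite lookup-mergeWP S z α β l i with toℕ i ≤ᵇ toℕ l
    ... | true  = trans (lab-relabel _ length≡ (lab∈S t∈S))
                    (trans (cong (merge _ _) (lab-idem t∈S)) (sym (lab-relabel _ length≡ t∈S)))
    ... | false = lab-idem t∈S

  Compatible-↓ : ∀ {k} {z z′ : WP k} → Leq S z z′ → Compatible z′ → Compatible z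
  Compatible-↓ ε         = λ c → c
  Compatible-↓ (c ◅ z≤z′) = Compatible-cover c ∘ Compatible-↓ z≤z′

  mergedElement : ∀ {k} {z z′ : WP k} → Cover S z z′ → ℕ
  mergedElement (cover α _ _ _ _ _ _ _ _ _ _) = α

  Cover-restrict-left : ∀ {k} {z z′ : WP k} (c : Cover S z z′) → Compatible z′ → side (mergedElement c) ≡ true →
    Cover left (restrict S z left) (restrict S z′ left) × restrict S z right ≡ restrict S z′ right
  Cover-restrict-left {z = z@(p ∷ _)} {z′} c@(cover α β l hz α∈S β∈S α<β different β-min α-min refl) compatible′ sα =
    cover α β l (isWP-restrict-left z hz compatible) α∈C β∈C α<β
      (λ eq → different (trans (sym (lab∘map (lab S p) α∈C)) (trans eq (lab∘map (lab S p) β∈C))))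
      (trans (lab∘map (lab S p) β∈C) β-min)
      (trans (cong (λ p → lab left p α) (lookup-restrict S z left l)) (trans (lab∘map _ α∈C) α-min))
      (lookup-extensionality merged-on-left)
    , lookup-extensionality unchanged-on-right
    where
    compatible : Compatible z
    compatible = Compatible-cover c compatible′
    len : length p ≡ length S
    len = IsPartition.length≡ (isWP⇒IsPartition z uS hz zero)
    sβ : side β ≡ true
    sβ = begin
      side β                                     ≡⟨ compatible′ zero β∈S ⟨
      side (lab S (mergeLayer S p α β) β)        ≡⟨ cong side (lab-relabel _ len β∈S) ⟩
      side (merge (lab S p α) (lab S p β) (lab S p β)) ≡⟨ cong side (trans (merge-right (lab S p α) _) (sym (merge-left _ (lab S p β)))) ⟩
      side (merge (lab S p α) (lab S p β) (lab S p α)) ≡⟨ cong side (lab-relabel _ len α∈S) ⟨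
      side (lab S (mergeLayer S p α β) α)        ≡⟨ compatible′ zero α∈S ⟩
      side α                                     ≡⟨ sα ⟩
      true                                       ∎
      where open ≡-Reasoning
    α∈C : α ∈ left
    α∈C = from ∈left⇔ (α∈S , from T-≡ sα)
    β∈C : β ∈ left
    β∈C = from ∈left⇔ (β∈S , from T-≡ sβ)
    merged-on-left : ∀ i → lookup (restrict S z′ left) i ≡ lookup (mergeWP left (restrict S z left) α β l) i
    merged-on-left i rewrite lookup-restrict S z′ left i | lookup-mergeWP S z α β l i
                           | lookup-mergeWP left (restrict S z left) α β l i | lookup-restrict S z left i
                           with toℕ i ≤ᵇ toℕ l
    ... | false = refl
    ... | true  = begin
      map (lab S (mergeLayer S zi α β)) left                   ≡⟨ List.map-cong-local (All.tabulate (lab-relabel _ length≡ ∘ left⊆S)) ⟩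
      map (merge (lab S zi α) (lab S zi β) ∘ lab S zi) left    ≡⟨ List.map-∘ left ⟩
      map (merge (lab S zi α) (lab S zi β)) (map (lab S zi) left)
        ≡⟨ cong₂ (λ a b → map (merge a b) (map (lab S zi) left)) (lab∘map (lab S zi) α∈C) (lab∘map (lab S zi) β∈C) ⟨
      mergeLayer left (map (lab S zi) left) α β                ∎
      where
      open ≡-Reasoning
      zi : Layer
      zi = lookup z i
      open IsPartition (isWP⇒IsPartition z uS hz i)
    unchanged-on-right : ∀ i → lookup (restrict S z right) i ≡ lookup (restrict S z′ right) i
    unchanged-on-right i rewrite lookup-restrict S z′ right i | lookup-mergeWP S z α β l i | lookup-restrict S z right i
                                with toℕ i ≤ᵇ toℕ l
    ... | false = refl
    ... | true  = List.map-cong-local (All.tabulate untouched)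
      where
      zi : Layer
      zi = lookup z i
      open IsPartition (isWP⇒IsPartition z uS hz i)
      untouched : ∀ {t} → t ∈ right → lab S zi t ≡ lab S (mergeLayer S zi α β) t
      untouched {t} t∈D = sym (trans (lab-relabel _ length≡ (right⊆S t∈D)) (merge-other (not-merged α∈C) (not-merged β∈C)))
        where
        not-merged : ∀ {u} → u ∈ left → lab S zi t ≢ lab S zi u
        not-merged {u} u∈C eq = left≢right
          (from ∈left⇔ (lab∈S (left⊆S u∈C) , from T-≡ (trans (compatible i (left⊆S u∈C)) (side-left u∈C))))
          (from ∈right⇔ (lab∈S (right⊆S t∈D) , from T-not-≡ (trans (compatible i (right⊆S t∈D)) (side-right t∈D))))
          (sym eq)

  Cover-glue-left : ∀ {k} {a a′ : WP k} (b : WP k) → Cover left a a′ → T (isWP right b) → Cover S (glue a b) (glue a′ b)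
  Cover-glue-left {a = a@(p ∷ _)} b@(q ∷ _) (cover α β l ha α∈C β∈C α<β different β-min α-min refl) hb =
    cover α β l (isWP-glue a b ha hb) (left⊆S α∈C) (left⊆S β∈C) α<β
      (λ eq → different (trans (sym (lab-glue-left p q α∈C)) (trans eq (lab-glue-left p q β∈C))))
      (trans (lab-glue-left p q β∈C) β-min)
      (trans (cong (λ r → lab S r α) (Vec.lookup-zipWith glueLayer l a b)) (trans (lab-glue-left _ _ α∈C) α-min))
      (lookup-extensionality merged)
    where
    merged : ∀ i → lookup (glue (mergeWP left a α β l) b) i ≡ lookup (mergeWP S (glue a b) α β l) i
    merged i rewrite Vec.lookup-zipWith glueLayer i (mergeWP left a α β l) b | lookup-mergeWP S (glue a b) α β l i
                   | lookup-mergeWP left a α β l i | Vec.lookup-zipWith glueLayer i a b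
                   with toℕ i ≤ᵇ toℕ l
    ... | false = refl
    ... | true  = trans (List.map-cong-local (All.tabulate merge-glued)) (trans (List.map-∘ S)
        (sym (cong₂ (λ x y → map (merge x y) (glueLayer ai bi)) (lab-glue-left ai bi α∈C) (lab-glue-left ai bi β∈C))))
      where
      ai bi : Layer
      ai = lookup a i
      bi = lookup b i
      A : IsPartition left ai
      A = isWP⇒IsPartition a left-unique ha i
      B : IsPartition right bi
      B = isWP⇒IsPartition b right-unique hb i
      merge-glued : ∀ {s} → s ∈ S →
        (if side s then lab left (mergeLayer left ai α β) s else lab right bi s)
          ≡ merge (lab left ai α) (lab left ai β) (if side s then lab left ai s else lab right bi s)
      merge-glued {s} s∈S with left-or-right s∈S
      ... | inj₁ s∈C rewrite side-left s∈C = lab-relabel _ (IsPartition.length≡ A) s∈C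
      ... | inj₂ s∈D rewrite side-right s∈D = sym (merge-other (not-merged α∈C) (not-merged β∈C))
        where
        not-merged : ∀ {u} → u ∈ left → lab right bi s ≢ lab left ai u
        not-merged u∈C eq = left≢right (IsPartition.lab∈S A u∈C) (IsPartition.lab∈S B s∈D) (sym eq)

  Leq-glue-left : ∀ {k} {a a′ : WP k} (b : WP k) → Leq left a a′ → T (isWP right b) → Leq S (glue a b) (glue a′ b)
  Leq-glue-left b ε          hb = ε
  Leq-glue-left b (c ◅ a≤a′) hb = Cover-glue-left b c hb ◅ Leq-glue-left b a≤a′ hb

module Split {S : List ℕ} (uS : Unique S) (σ : Splitting S) where

  open Splitting σ
  open Gluing uS σ public
  private module Swapped = Gluing uS (swap σ)

  Compatible-swap : ∀ {k} (z : WP k) → Compatible z → Swapped.Compatible z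
  Compatible-swap z compatible i t∈S = cong not (compatible i t∈S)

  glue-swap : ∀ {k} (a b : WP k) → Swapped.glue b a ≡ glue a b
  glue-swap a b = lookup-extensionality λ i →
    trans (Vec.lookup-zipWith Swapped.glueLayer i b a)
      (trans (List.map-cong (λ s → if-not (side s)) S) (sym (Vec.lookup-zipWith glueLayer i a b)))
    where
    if-not : ∀ {A : Set} {x y : A} c → (if not c then y else x) ≡ (if c then x else y)
    if-not true  = refl
    if-not false = refl

  restrict-glue-right : ∀ {k} (a b : WP k) → T (isWP right b) → restrict S (glue a b) right ≡ b
  restrict-glue-right a b hb = trans (cong (λ z → restrict S z right) (sym (glue-swap a b))) (Swapped.restrict-glue-left b a hb)

  isWP-restrict-right : ∀ {k} (z : WP k) → T (isWP S z) → Compatible z → T (isWP right (restrict S z right))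
  isWP-restrict-right z hz = Swapped.isWP-restrict-left z hz ∘ Compatible-swap z

  Leq-glue-right : ∀ {k} (a : WP k) {b b′ : WP k} → Leq right b b′ → T (isWP left a) → Leq S (glue a b) (glue a b′)
  Leq-glue-right a {b} {b′} b≤b′ ha = subst₂ (Leq S) (glue-swap a b) (glue-swap a b′) (Swapped.Leq-glue-left a b≤b′ ha)

  Leq-glue : ∀ {k} {a a′ b b′ : WP k} → Leq left a a′ → Leq right b b′ → T (isWP left a′) → T (isWP right b) →
    Leq S (glue a b) (glue a′ b′)
  Leq-glue {b = b} a≤a′ b≤b′ ha′ hb = Leq-glue-left b a≤a′ hb ◅◅ Leq-glue-right _ b≤b′ ha′

  Cover-restrict : ∀ {k} {z z′ : WP k} → Cover S z z′ → Compatible z′ →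
    (Cover left (restrict S z left) (restrict S z′ left) × restrict S z right ≡ restrict S z′ right) ⊎
    (restrict S z left ≡ restrict S z′ left × Cover right (restrict S z right) (restrict S z′ right))
  Cover-restrict {z′ = z′} c compatible′ with side (mergedElement c) in sα
  ... | true  = inj₁ (Cover-restrict-left c compatible′ sα)
  ... | false = let cover-right , same-left = Swapped.Cover-restrict-left c (Compatible-swap z′ compatible′) (cong not sα)
                in inj₂ (same-left , cover-right)

  Leq-restrict : ∀ {k} {z z′ : WP k} → Leq S z z′ → Compatible z′ →
    Leq left (restrict S z left) (restrict S z′ left) × Leq right (restrict S z right) (restrict S z′ right)
  Leq-restrict ε           _           = ε , ε
  Leq-restrict {z′ = z′} (c ◅ z≤z′) compatible′ with Leq-restrict z≤z′ compatible′ | Cover-restrict c (Compatible-↓ z≤z′ compatible′)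
  ... | onC , onD | inj₁ (cC , sameD) = cC ◅ onC , subst (λ w → Leq right w (restrict S z′ right)) (sym sameD) onD
  ... | onC , onD | inj₂ (sameC , cD) = subst (λ w → Leq left w (restrict S z′ left)) (sym sameC) onC , cD ◅ onD

-- The product formula for one splitting

module ProductFormula (dec : LeqDec) (k : ℕ) {S : List ℕ} (uS : Unique S) (σ : Splitting S) where

  open Splitting σ
  open Split uS σ
  module MS = Möbius dec k uS
  module MC = Möbius dec k left-unique
  module MD = Möbius dec k right-unique

  0S 0C 0D : WP k
  0S = zeroWP S
  0C = zeroWP left
  0D = zeroWP right

  infix 25 _∣C _∣D
  _∣C _∣D : WP k → WP k
  z ∣C = restrict S z left
  z ∣D = restrict S z right

  glue-zeroWP : glue 0C 0D ≡ 0S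
  glue-zeroWP = begin
    glue 0C 0D                ≡⟨ cong₂ glue (restrict-zeroWP {k} S left) (restrict-zeroWP {k} S right) ⟨
    glue (0S ∣C) (0S ∣D)      ≡⟨ glue-restrict 0S (isWP-zeroWP {k} uS) ⟩
    0S                        ∎
    where open ≡-Reasoning

  Leq-restrict-zero : ∀ {y} → Leq S 0S y → Compatible y → Leq left 0C (y ∣C) × Leq right 0D (y ∣D)
  Leq-restrict-zero {y} 0≤y compatible with Leq-restrict 0≤y compatible
  ... | onC , onD = subst (λ w → Leq left w (y ∣C)) (restrict-zeroWP S left) onC
                  , subst (λ w → Leq right w (y ∣D)) (restrict-zeroWP S right) onD

  μ-product : WP k → ℤ
  μ-product y = μ dec left 0C (y ∣C) * μ dec right 0D (y ∣D)

  module Interval {y : WP k} (hy : T (isWP S y)) (compatible : Compatible y) where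

    L Lᶜ Lᵈ : List (WP k)
    L  = MS.interval 0S y
    Lᶜ = MC.interval 0C (y ∣C)
    Lᵈ = MD.interval 0D (y ∣D)

    restrictions : WP k → WP k × WP k
    restrictions z = z ∣C , z ∣D

    restrictions∈ : ∀ {z} → z ∈ L → restrictions z ∈ cartesianProduct Lᶜ Lᵈ
    restrictions∈ {z} z∈L with to MS.∈interval⇔ z∈L
    ... | z∈E , 0≤z , z≤y = ∈-cartesianProduct⁺
      (from MC.∈interval⇔ (enumWP-complete left-unique (isWP-restrict-left z hz compatible-z) , proj₁ 0≤z∣ , proj₁ z∣≤y∣))
      (from MD.∈interval⇔ (enumWP-complete right-unique (isWP-restrict-right z hz compatible-z) , proj₂ 0≤z∣ , proj₂ z∣≤y∣))
      where
      hz : T (isWP S z)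
      hz = enumWP-sound z∈E
      compatible-z : Compatible z
      compatible-z = Compatible-↓ z≤y compatible
      0≤z∣ : Leq left 0C (z ∣C) × Leq right 0D (z ∣D)
      0≤z∣ = Leq-restrict-zero 0≤z compatible-z
      z∣≤y∣ : Leq left (z ∣C) (y ∣C) × Leq right (z ∣D) (y ∣D)
      z∣≤y∣ = Leq-restrict z≤y compatible

    glue∈L : ∀ {a b} → a ∈ Lᶜ → b ∈ Lᵈ → glue a b ∈ L
    glue∈L {a} {b} a∈Lᶜ b∈Lᵈ with to MC.∈interval⇔ a∈Lᶜ | to MD.∈interval⇔ b∈Lᵈ
    ... | a∈E , 0≤a , a≤y | b∈E , 0≤b , b≤y = from MS.∈interval⇔
      ( enumWP-complete uS (isWP-glue a b ha hb)
      , subst (λ w → Leq S w (glue a b)) glue-zeroWP (Leq-glue 0≤a 0≤b ha (isWP-zeroWP {k} right-unique))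
      , subst (Leq S (glue a b)) (glue-restrict y hy) (Leq-glue a≤y b≤y (isWP-restrict-left y hy compatible) hb) )
      where
      ha : T (isWP left a)
      ha = enumWP-sound a∈E
      hb : T (isWP right b)
      hb = enumWP-sound b∈E

    restrictions-glue : ∀ {a b} → a ∈ Lᶜ → b ∈ Lᵈ → restrictions (glue a b) ≡ (a , b)
    restrictions-glue {a} {b} a∈Lᶜ b∈Lᵈ = cong₂ _,_
      (restrict-glue-left a b (enumWP-sound (proj₁ (to MC.∈interval⇔ a∈Lᶜ))))
      (restrict-glue-right a b (enumWP-sound (proj₁ (to MD.∈interval⇔ b∈Lᵈ))))

    restrictions-unique : Unique (map restrictions L)
    restrictions-unique = Unique.map⁻ (subst Unique (sym glue-restrictions) (filterᵇ-unique _ (enumWP-unique k uS)))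
      where
      glue-restrictions : map (λ p → glue (proj₁ p) (proj₂ p)) (map restrictions L) ≡ L
      glue-restrictions = trans (sym (List.map-∘ L))
        (trans (List.map-cong-local (All.tabulate λ z∈L → glue-restrict _ (enumWP-sound (proj₁ (to MS.∈interval⇔ z∈L)))))
               (List.map-id L))

    same-elements : ∀ {p} → p ∈ map restrictions L ⇔ p ∈ cartesianProduct Lᶜ Lᵈ
    same-elements = mk⇔
      (λ p∈ → let z , z∈L , p≡ = ∈-map⁻ restrictions p∈ in subst (_∈ _) (sym p≡) (restrictions∈ z∈L))
      (λ p∈ → let a∈ , b∈ = ∈-cartesianProduct⁻ Lᶜ Lᵈ p∈ in
        subst (_∈ map restrictions L) (restrictions-glue a∈ b∈) (∈-map⁺ restrictions (glue∈L a∈ b∈)))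

    interval-sum : sumIf MS.E (MS.between 0S y) μ-product
      ≡ sumIf MC.E (MC.between 0C (y ∣C)) (μ dec left 0C) * sumIf MD.E (MD.between 0D (y ∣D)) (μ dec right 0D)
    interval-sum = begin
      sumIf MS.E (MS.between 0S y) μ-product
        ≡⟨ sumIf-filter MS.E _ μ-product ⟩
      sumℤ (map μ-product L)
        ≡⟨ cong sumℤ (List.map-∘ L) ⟩
      sumℤ (map F (map restrictions L))
        ≡⟨ sumℤ-map-unique F restrictions-unique
             (Unique.cartesianProduct⁺ (filterᵇ-unique _ (enumWP-unique k left-unique)) (filterᵇ-unique _ (enumWP-unique k right-unique)))
             same-elements ⟩
      sumℤ (map F (cartesianProduct Lᶜ Lᵈ))
        ≡⟨ sumℤ-cartesianProduct (μ dec left 0C) (μ dec right 0D) Lᶜ Lᵈ ⟩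
      sumℤ (map (μ dec left 0C) Lᶜ) * sumℤ (map (μ dec right 0D) Lᵈ)
        ≡⟨ cong₂ _*_ (sumIf-filter MC.E _ _) (sumIf-filter MD.E _ _) ⟨
      sumIf MC.E (MC.between 0C (y ∣C)) (μ dec left 0C) * sumIf MD.E (MD.between 0D (y ∣D)) (μ dec right 0D) ∎
      where
      open ≡-Reasoning
      F : WP k × WP k → ℤ
      F p = μ dec left 0C (proj₁ p) * μ dec right 0D (proj₂ p)

  sum-μ-product : ∀ {y} → T (isWP S y) → Compatible y → 0S ≢ y → Leq S 0S y →
    sumIf MS.E (MS.between 0S y) μ-product ≡ 0ℤ
  sum-μ-product {y} hy compatible 0≢y 0≤y =
    trans (Interval.interval-sum hy compatible) (one-factor-vanishes (y ∣C ≟WP 0C) (y ∣D ≟WP 0D))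
    where
    ΣC ΣD : ℤ
    ΣC = sumIf MC.E (MC.between 0C (y ∣C)) (μ dec left 0C)
    ΣD = sumIf MD.E (MD.between 0D (y ∣D)) (μ dec right 0D)
    0≤y∣ : Leq left 0C (y ∣C) × Leq right 0D (y ∣D)
    0≤y∣ = Leq-restrict-zero 0≤y compatible
    hy∣C : T (isWP left (y ∣C))
    hy∣C = isWP-restrict-left y hy compatible
    hy∣D : T (isWP right (y ∣D))
    hy∣D = isWP-restrict-right y hy compatible
    one-factor-vanishes : Dec (y ∣C ≡ 0C) → Dec (y ∣D ≡ 0D) → ΣC * ΣD ≡ 0ℤ
    one-factor-vanishes (no y∣C≢0) _ =
      trans (cong (_* ΣD) (MC.sum-μ-≢ (y∣C≢0 ∘ sym) (proj₁ 0≤y∣) (enumWP-complete left-unique hy∣C))) (ℤ.*-zeroˡ ΣD)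
    one-factor-vanishes (yes _) (no y∣D≢0) =
      trans (cong (ΣC *_) (MD.sum-μ-≢ (y∣D≢0 ∘ sym) (proj₂ 0≤y∣) (enumWP-complete right-unique hy∣D))) (ℤ.*-zeroʳ ΣC)
    one-factor-vanishes (yes y∣C≡0) (yes y∣D≡0) = contradiction
      (trans (sym glue-zeroWP) (trans (sym (cong₂ glue y∣C≡0 y∣D≡0)) (glue-restrict y hy))) 0≢y

  μ-split : ∀ Y → T (isWP S Y) → Compatible Y → μ dec S 0S Y ≡ μ-product Y
  μ-split Y hY compatible with dec S 0S Y
  ... | yes 0≤Y = MS.μ-unique μ-product hY product-at-zero
    (λ 0≢y 0≤y y≤Y → sum-μ-product (Leq⇒isWP y≤Y hY) (Compatible-↓ y≤Y compatible) 0≢y 0≤y) 0≤Y ε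
    where
    product-at-zero : μ-product 0S ≡ 1ℤ
    product-at-zero rewrite restrict-zeroWP {k} S left | restrict-zeroWP {k} S right
                          | MC.μ-refl 0C | MD.μ-refl 0D = refl
  ... | no 0≰Y with dec left 0C (Y ∣C) | dec right 0D (Y ∣D)
  ... | no 0≰Y∣C | _ = trans (MS.μ-incomparable 0≰Y) (sym (trans (cong (_* μD) (MC.μ-incomparable 0≰Y∣C)) (ℤ.*-zeroˡ μD)))
    where μD = μ dec right 0D (Y ∣D)
  ... | yes _ | no 0≰Y∣D = trans (MS.μ-incomparable 0≰Y) (sym (trans (cong (μC *_) (MD.μ-incomparable 0≰Y∣D)) (ℤ.*-zeroʳ μC)))
    where μC = μ dec left 0C (Y ∣C)
  ... | yes 0≤Y∣C | yes 0≤Y∣D = contradiction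
    (subst₂ (Leq S) glue-zeroWP (glue-restrict Y hY) (Leq-glue 0≤Y∣C 0≤Y∣D (isWP-restrict-left Y hY compatible) (isWP-zeroWP {k} right-unique)))
    0≰Y

-- Induction on the blocks of the first layer

filterᵇ-cong-local : {X : Set} {a b : X → Bool} (L : List X) → (∀ {x} → x ∈ L → a x ≡ b x) → filterᵇ a L ≡ filterᵇ b L
filterᵇ-cong-local [] a≗b = refl
filterᵇ-cong-local {b = b} (x ∷ L) a≗b rewrite a≗b (here refl) with b x
... | true  = cong (x ∷_) (filterᵇ-cong-local L (a≗b ∘ there))
... | false = filterᵇ-cong-local L (a≗b ∘ there)

filterᵇ-comm : {X : Set} (a b : X → Bool) (L : List X) → filterᵇ a (filterᵇ b L) ≡ filterᵇ b (filterᵇ a L)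
filterᵇ-comm a b [] = refl
filterᵇ-comm a b (x ∷ L) with a x in ax | b x in bx
... | true  | true  rewrite ax | bx = cong (x ∷_) (filterᵇ-comm a b L)
... | true  | false rewrite bx = filterᵇ-comm a b L
... | false | true  rewrite ax = filterᵇ-comm a b L
... | false | false = filterᵇ-comm a b L

filterᵇ-all : {X : Set} (b : X → Bool) {L : List X} → (∀ {x} → x ∈ L → T (b x)) → filterᵇ b L ≡ L
filterᵇ-all b all-b = List.filter-all (T? ∘ b) (All.tabulate all-b)

splitBy : ∀ {S} → Unique S → (ℕ → Bool) → Splitting S
splitBy {S} uS side = record
  { side = side ; left = filterᵇ side S ; right = filterᵇ (not ∘ side) S
  ; left-unique = filterᵇ-unique side uS ; right-unique = filterᵇ-unique (not ∘ side) uS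
  ; ∈left⇔ = ∈-filterᵇ⇔ side S ; ∈right⇔ = ∈-filterᵇ⇔ (not ∘ side) S
  }

isMinimum : List ℕ → Layer → ℕ → Bool
isMinimum S p t = lab S p t ≡ᵇ t

blockOf : List ℕ → Layer → ℕ → List ℕ
blockOf S p m = filterᵇ (λ t → lab S p t ≡ᵇ m) S

module Peel {S : List ℕ} (uS : Unique S) {p : Layer} {m : ℕ} {ms : List ℕ}
            (minima : filterᵇ (isMinimum S p) S ≡ m ∷ ms) where

  inFirst : ℕ → Bool
  inFirst t = lab S p t ≡ᵇ m

  D : List ℕ
  D = filterᵇ (not ∘ inFirst) S

  pD : Layer
  pD = map (lab S p) D

  m∈S : m ∈ S
  m∈S = proj₁ (to (∈-filterᵇ⇔ (isMinimum S p) S) (subst (m ∈_) (sym minima) (here refl)))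

  inFirst-m : T (inFirst m)
  inFirst-m = proj₂ (to (∈-filterᵇ⇔ (isMinimum S p) S) (subst (m ∈_) (sym minima) (here refl)))

  D-shorter : length D < length S
  D-shorter = List.filter-notAll (T? ∘ not ∘ inFirst) S (Any.map (λ { refl → subst T (cong not (to T-≡ inFirst-m)) }) m∈S)

  notInFirst : ∀ {m′} → m′ ∈ ms → ∀ {t} → lab S p t ≡ m′ → T (not (inFirst t))
  notInFirst {m′} m′∈ms {t} lab≡m′ with subst Unique minima (filterᵇ-unique (isMinimum S p) uS)
  ... | m∉ms ∷ _ = from T-not-≡ (trans (cong (_≡ᵇ m) lab≡m′) (≡ᵇ-false {m′} {m} λ { refl → All.lookup m∉ms m′∈ms refl }))

  minima-D : filterᵇ (isMinimum D pD) D ≡ ms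
  minima-D = begin
    filterᵇ (isMinimum D pD) D                          ≡⟨ filterᵇ-cong-local D (λ t∈D → cong (_≡ᵇ _) (lab∘map (lab S p) t∈D)) ⟩
    filterᵇ (isMinimum S p) D                           ≡⟨ filterᵇ-comm (isMinimum S p) (not ∘ inFirst) S ⟩
    filterᵇ (not ∘ inFirst) (filterᵇ (isMinimum S p) S) ≡⟨ cong (filterᵇ (not ∘ inFirst)) minima ⟩
    filterᵇ (not ∘ inFirst) (m ∷ ms)                    ≡⟨ List.filter-reject (T? ∘ not ∘ inFirst) (λ h → subst T (cong not (to T-≡ inFirst-m)) h) ⟩
    filterᵇ (not ∘ inFirst) ms                          ≡⟨ filterᵇ-all (not ∘ inFirst) (λ m′∈ms → notInFirst m′∈ms (minimum m′∈ms)) ⟩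
    ms                                                  ∎
    where
    open ≡-Reasoning
    minimum : ∀ {m′} → m′ ∈ ms → lab S p m′ ≡ m′
    minimum m′∈ms = to T-≡ᵇ⇔ (proj₂ (to (∈-filterᵇ⇔ (isMinimum S p) S) (subst (_ ∈_) (sym minima) (there m′∈ms))))

  blocks-D : ∀ {m′} → m′ ∈ ms → blockOf D pD m′ ≡ blockOf S p m′
  blocks-D {m′} m′∈ms = begin
    blockOf D pD m′                                ≡⟨ filterᵇ-cong-local D (λ t∈D → cong (_≡ᵇ m′) (lab∘map (lab S p) t∈D)) ⟩
    filterᵇ (λ t → lab S p t ≡ᵇ m′) D               ≡⟨ filterᵇ-comm _ (not ∘ inFirst) S ⟩
    filterᵇ (not ∘ inFirst) (blockOf S p m′)        ≡⟨ filterᵇ-all (not ∘ inFirst) (λ t∈B → notInFirst m′∈ms (to T-≡ᵇ⇔ (proj₂ (to (∈-filterᵇ⇔ _ S) t∈B)))) ⟩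
    blockOf S p m′                                  ∎
    where open ≡-Reasoning

  blockOf⊆D : ∀ {m′} → m′ ∈ ms → ∀ {t} → t ∈ blockOf S p m′ → t ∈ D
  blockOf⊆D m′∈ms t∈B with to (∈-filterᵇ⇔ _ S) t∈B
  ... | t∈S , in-m′ = from (∈-filterᵇ⇔ _ S) (t∈S , notInFirst m′∈ms (to T-≡ᵇ⇔ in-m′))

length≡0⇒[] : ∀ {A : Set} {xs : List A} → length xs ≡ 0 → xs ≡ []
length≡0⇒[] {xs = []} _ = refl

μ-zero-factorises : (dec : LeqDec) (k : ℕ) (S : List ℕ) → Acc _<_ (length S) → Unique S →
  (π : WP (suc k)) → T (isWP S π) →
  μ dec S (zeroWP S) π ≡ productℤ (map (λ B → μ dec B (zeroWP B) (restrict S π B)) (blocks1 S π))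
μ-zero-factorises dec k [] _ uS π hπ = trans (cong (μ dec [] (zeroWP [])) π≡0) (Möbius.μ-refl dec (suc k) uS (zeroWP []))
  where
  π≡0 : π ≡ zeroWP []
  π≡0 = lookup-extensionality λ i →
    trans (length≡0⇒[] (IsPartition.length≡ (isWP⇒IsPartition π uS hπ i))) (sym (Vec.lookup∘tabulate (λ _ → []) i))
μ-zero-factorises dec k S@(s ∷ _) (acc smaller) uS π@(p ∷ ps) hπ with filterᵇ (isMinimum S p) S in minima
... | [] = contradiction (subst (lab S p s ∈_) minima (from (∈-filterᵇ⇔ (isMinimum S p) S)
             (lab∈S (here refl) , from T-≡ᵇ⇔ (lab-idem (here refl))))) λ ()
  where open IsPartition (isWP⇒IsPartition π uS hπ zero)
... | m ∷ ms = begin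
  μ dec S (zeroWP S) π
    ≡⟨ ProductFormula.μ-split dec (suc k) uS σ π hπ compatible ⟩
  μ-block (blockOf S p m) * μ dec D (zeroWP D) πD
    ≡⟨ cong (μ-block (blockOf S p m) *_) (μ-zero-factorises dec k D (smaller D-shorter) (filterᵇ-unique (not ∘ inFirst) uS) πD hπD) ⟩
  μ-block (blockOf S p m) * productℤ (map μ-blockD (blocks1 D πD))
    ≡⟨ cong (λ bs → μ-block (blockOf S p m) * productℤ bs) blocks-of-D ⟩
  productℤ (map μ-block (map (blockOf S p) (m ∷ ms))) ∎
  where
  open ≡-Reasoning
  open Peel uS {p} minima
  σ : Splitting S
  σ = splitBy uS inFirst
  open Split uS σ using (Compatible; isWP-restrict-right)
  μ-block : List ℕ → ℤ
  μ-block B = μ dec B (zeroWP B) (restrict S π B)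
  πD : WP (suc k)
  πD = restrict S π D
  μ-blockD : List ℕ → ℤ
  μ-blockD B = μ dec B (zeroWP B) (restrict D πD B)
  compatible : Compatible π
  compatible i t∈S = cong (_≡ᵇ m) (isWP⇒Refines-layer1 hπ i (lab∈S t∈S) t∈S (lab-idem t∈S))
    where open IsPartition (isWP⇒IsPartition π uS hπ i)
  hπD : T (isWP D πD)
  hπD = isWP-restrict-right π hπ compatible
  blocks-of-D : map μ-blockD (blocks1 D πD) ≡ map μ-block (map (blockOf S p) ms)
  blocks-of-D = begin
    map μ-blockD (map (blockOf D pD) (filterᵇ (isMinimum D pD) D))
      ≡⟨ cong (λ mins → map μ-blockD (map (blockOf D pD) mins)) minima-D ⟩
    map μ-blockD (map (blockOf D pD) ms)
      ≡⟨ trans (sym (List.map-∘ ms)) (trans (List.map-cong-local (All.tabulate same-block)) (List.map-∘ ms)) ⟩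
    map μ-block (map (blockOf S p) ms) ∎
    where
    same-block : ∀ {m′} → m′ ∈ ms → μ-blockD (blockOf D pD m′) ≡ μ-block (blockOf S p m′)
    same-block {m′} m′∈ms rewrite blocks-D m′∈ms =
      cong (μ dec (blockOf S p m′) (zeroWP (blockOf S p m′))) (restrict-restrict S π (blockOf⊆D m′∈ms))

mainTheorem14 : (dec : LeqDec) (n k : ℕ) → 1 ≤ n → 1 ≤ k →
    (π : WP k) → T (isWP (range n) π) →
    μ dec (range n) (zeroWP (range n)) π
      ≡ productℤ (map (λ B → μ dec B (zeroWP B) (restrict (range n) π B))
                      (blocks1 (range n) π))
mainTheorem14 dec n (suc k) _ _ π hπ =
  μ-zero-factorises dec k (range n) (<-wellFounded _) (Unique.map⁺ ℕ.suc-injective (Unique.upTo⁺ n)) π hπ
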